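{- Let $p$ be a prime number and $\ell$ an odd prime number with $p\ell\in D_2(p)$. Fix a primitive $\ell$-th root of unity $\zeta_\ell\in\mathbb{F}_{p^2}^\times\setminus\mathbb{F}_p^\times$. For $j\in(\mathbb{Z}/\ell)^\times$ let $V^j_{p,\ell}=\mathbb{F}_p^{\oplus 2}$ be the representation of $\mathbb{Z}/\ell$ given by $1\bmod\ell\mapsto\begin{pmatrix}0&-1\\1&\zeta_\ell^j+\zeta_\ell^{pj}\end{pmatrix}\in\mathrm{GL}_2(\mathbb{F}_p)$. Then: (i) every $v\in V^j_{p,\ell}\setminus\{0\}$ satisfies $V^j_{p,\ell}=\langle v,(1\bmod\ell)\cdot v\rangle_{\mathbb{F}_p}$ and $(2\bmod\ell)\cdot v=(\zeta_\ell^j+\zeta_\ell^{pj})((1\bmod\ell)\cdot v)-v$; (ii) for $j_1,j_2\in(\mathbb{Z}/\ell)^\times$, $V^{j_1}_{p,\ell}\cong V^{j_2}_{p,\ell}$ if and only if $j_1=j_2$ or $j_1=pj_2$; (iii) every non-trivial 2-dimensional $\mathbb{F}_p$-representation of $\mathbb{Z}/\ell$ is isomorphic to $V^j_{p,\ell}$ for some $j\in(\mathbb{Z}/\ell)^\times$; (iv) for every $j\in(\mathbb{Z}/\ell)^\times$, $V^j_{p,\ell}$ satisfies (B) and (C) for $H'=\{0\}$ and any 1-dimensional subspace $L$.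
   Context: $D_2(p):=\{n\in p\mathbb{Z}_{>0}: \gcd(n,p+1)\text{ is not a power of }2\}$. For a representation $V$ of a finite group $G'$, a subgroup $H'$ and an $H'$-stable line $L\subset V$: condition (B) is $V^{G'}=\{0\}$; condition (C) is that the stabilizer of $L$ in $G'$ acts trivially on $L$. -}

module Defs where

open import Data.Nat as ℕ using (ℕ; zero; suc)
open import Data.Nat.GCD using (gcd)
open import Data.Nat.Divisibility as ND using ()
open import Data.Integer as ℤ using (ℤ; +_)
open import Data.Integer.Divisibility using () renaming (_∣_ to _∣ℤ_)
open import Data.Product using (Σ; ∃; ∃-syntax; _×_; _,_; proj₁; proj₂)
open import Relation.Nullary using (¬_)
open import Relation.Binary.PropositionalEquality using (_≡_)

IsPowerOf2 : ℕ → Set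
IsPowerOf2 m = ∃[ k ] m ≡ 2 ℕ.^ k

D₂ : ℕ → ℕ → Set
D₂ p n = (p ND.∣ n) × (0 ℕ.< n) × ¬ IsPowerOf2 (gcd n (p ℕ.+ 1))

ModEq : ℕ → ℤ → ℤ → Set
ModEq m a b = (+ m) ∣ℤ (a ℤ.- b)

-- (ℤ/ℓ)^× represented by j ∈ {1,…,ℓ-1}  (ℓ prime)
IsUnitRep : ℕ → ℕ → Set
IsUnitRep ℓ j = (1 ℕ.≤ j) × (j ℕ.< ℓ)

-- 𝔽_{p²} modelled as 𝔽_p[x]/(x² - a x - b) for an irreducible
-- monic quadratic x² - a x - b over 𝔽_p; an element (u , v) is u + v x.

Irreducible : ℕ → ℤ → ℤ → Set
Irreducible p a b = ∀ (r : ℤ) → ¬ ModEq p (r ℤ.* r ℤ.- a ℤ.* r ℤ.- b) (+ 0)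

E : Set
E = ℤ × ℤ

_≈E[_]_ : E → ℕ → E → Set
(u₁ , v₁) ≈E[ p ] (u₂ , v₂) = ModEq p u₁ u₂ × ModEq p v₁ v₂

oneE : E
oneE = (+ 1 , + 0)

addE : E → E → E
addE (u₁ , v₁) (u₂ , v₂) = (u₁ ℤ.+ u₂ , v₁ ℤ.+ v₂)

mulE : ℤ → ℤ → E → E → E
mulE a b (u₁ , v₁) (u₂ , v₂) =
  ( u₁ ℤ.* u₂ ℤ.+ b ℤ.* (v₁ ℤ.* v₂)
  , u₁ ℤ.* v₂ ℤ.+ v₁ ℤ.* u₂ ℤ.+ a ℤ.* (v₁ ℤ.* v₂) )

powE : ℤ → ℤ → E → ℕ → E
powE a b z zero    = oneE
powE a b z (suc n) = mulE a b z (powE a b z n)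

PrimitiveRoot : ℕ → ℤ → ℤ → ℕ → E → Set
PrimitiveRoot p a b ℓ z =
  (powE a b z ℓ ≈E[ p ] oneE) ×
  (∀ k → 0 ℕ.< k → k ℕ.< ℓ → ¬ (powE a b z k ≈E[ p ] oneE))

NotInPrimeField : ℕ → E → Set
NotInPrimeField p (u , v) = ¬ ModEq p v (+ 0)

-- 2×2 matrices and vectors over 𝔽_p (entries in ℤ, equality mod p)

V2 : Set
V2 = ℤ × ℤ

M2 : Set
M2 = (ℤ × ℤ) × (ℤ × ℤ)     -- ((m₁₁ , m₁₂) , (m₂₁ , m₂₂))

_≈V[_]_ : V2 → ℕ → V2 → Set
(x₁ , y₁) ≈V[ p ] (x₂ , y₂) = ModEq p x₁ x₂ × ModEq p y₁ y₂

_≈M[_]_ : M2 → ℕ → M2 → Set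
(r₁ , s₁) ≈M[ p ] (r₂ , s₂) = (r₁ ≈V[ p ] r₂) × (s₁ ≈V[ p ] s₂)

zeroV : V2
zeroV = (+ 0 , + 0)

addV : V2 → V2 → V2
addV (x₁ , y₁) (x₂ , y₂) = (x₁ ℤ.+ x₂ , y₁ ℤ.+ y₂)

negV : V2 → V2
negV (x , y) = (ℤ.- x , ℤ.- y)

scaleV : ℤ → V2 → V2
scaleV c (x , y) = (c ℤ.* x , c ℤ.* y)

idM : M2
idM = ((+ 1 , + 0) , (+ 0 , + 1))

apply : M2 → V2 → V2
apply ((m₁₁ , m₁₂) , (m₂₁ , m₂₂)) (x , y) =
  (m₁₁ ℤ.* x ℤ.+ m₁₂ ℤ.* y , m₂₁ ℤ.* x ℤ.+ m₂₂ ℤ.* y)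

mulM : M2 → M2 → M2
mulM ((a₁₁ , a₁₂) , (a₂₁ , a₂₂)) ((b₁₁ , b₁₂) , (b₂₁ , b₂₂)) =
  ( (a₁₁ ℤ.* b₁₁ ℤ.+ a₁₂ ℤ.* b₂₁ , a₁₁ ℤ.* b₁₂ ℤ.+ a₁₂ ℤ.* b₂₂)
  , (a₂₁ ℤ.* b₁₁ ℤ.+ a₂₂ ℤ.* b₂₁ , a₂₁ ℤ.* b₁₂ ℤ.+ a₂₂ ℤ.* b₂₂) )

powM : M2 → ℕ → M2
powM A zero    = idM
powM A (suc n) = mulM A (powM A n)

-- The group ℤ/ℓ is ℕ modulo ℓ; a representation is ρ : ℕ → M₂(𝔽_p)
-- which is a monoid homomorphism (ℕ,+) → M₂(𝔽_p) that factors through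
-- ℤ/ℓ (ρ ℓ = 1). Its image lies in GL₂ automatically (ρ g ρ (ℓ-1)g = 1).

IsRep : ℕ → ℕ → (ℕ → M2) → Set
IsRep p ℓ ρ =
  (ρ 0 ≈M[ p ] idM) ×
  (∀ g h → ρ (g ℕ.+ h) ≈M[ p ] mulM (ρ g) (ρ h)) ×
  (ρ ℓ ≈M[ p ] idM)

RepIso : ℕ → (ℕ → M2) → (ℕ → M2) → Set
RepIso p ρ σ =
  Σ M2 λ P → Σ M2 λ Q →
    (mulM P Q ≈M[ p ] idM) × (mulM Q P ≈M[ p ] idM) ×
    (∀ g → mulM P (ρ g) ≈M[ p ] mulM (σ g) P)

NonTrivial : ℕ → (ℕ → M2) → Set
NonTrivial p ρ = ∃[ g ] ¬ (ρ g ≈M[ p ] idM)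

Spans : ℕ → V2 → V2 → Set
Spans p v w = ∀ (x : V2) → ∃[ c ] ∃[ d ] (x ≈V[ p ] addV (scaleV c v) (scaleV d w))

ConditionB : ℕ → (ℕ → M2) → Set
ConditionB p ρ = ∀ (v : V2) → (∀ g → apply (ρ g) v ≈V[ p ] v) → v ≈V[ p ] zeroV

StabilisesLine : ℕ → (ℕ → M2) → V2 → ℕ → Set
StabilisesLine p ρ w g =
  (∀ c → ∃[ d ] (apply (ρ g) (scaleV c w) ≈V[ p ] scaleV d w)) ×
  (∀ d → ∃[ c ] (scaleV d w ≈V[ p ] apply (ρ g) (scaleV c w)))

ConditionC : ℕ → (ℕ → M2) → V2 → Set
ConditionC p ρ w =
  ∀ g → StabilisesLine p ρ w g →
    ∀ c → apply (ρ g) (scaleV c w) ≈V[ p ] scaleV c w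

-- ζ^j + ζ^{pj}; lies in 𝔽_p, so its first coordinate is the 𝔽_p element
traceE : ℤ → ℤ → E → ℕ → ℕ → ℤ
traceE a b ζ p j = proj₁ (addE (powE a b ζ j) (powE a b ζ (p ℕ.* j)))

Vmat : ℕ → ℤ → ℤ → E → ℕ → M2
Vmat p a b ζ j = ((+ 0 , ℤ.- (+ 1)) , (+ 1 , traceE a b ζ p j))

Vrep : ℕ → ℤ → ℤ → E → ℕ → (ℕ → M2)
Vrep p a b ζ j g = powM (Vmat p a b ζ j) g

-- Modulo p, E = 𝔽_p[x]/(x² - a x - b) is a field (its norm form is anisotropic), and since
-- ℓ ∣ p + 1 the element ζ^{pj} is both the inverse and the conjugate of ζʲ. Hence
-- tⱼ = ζʲ + ζ^{pj} ∈ 𝔽_p, ζʲ is a root of x² - tⱼ x + 1, and V^j is the companion matrix of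
-- this polynomial. The binary form x² - tⱼ x y + y² then has no nontrivial zero, which gives
-- (i) and (B); Cayley–Hamilton writes Aⁿ = αₙ + βₙ A with the same coefficients as
-- ζ^{jn} = αₙ + βₙ ζʲ, so A^ℓ = 1, and (C) holds because 𝔽_p contains no ℓ-th root of
-- unity other than 1. Similar matrices have equal traces, and tⱼ₁ = tⱼ₂ amounts to
-- (ζ^{j₁} - ζ^{j₂})(ζ^{j₁ + j₂} - 1) = 0, giving (ii). For (iii), ρ(1) is not scalar, so it
-- has a cyclic vector and is conjugate to the companion matrix of some x² - T x + 1 whose
-- ℓ-th power is 1; summing over all ℓ-th roots of unity shows that such a polynomial has a
-- root ζᵏ with k ≠ 0, so T = tₖ.

module Submission where

open import Level using (0ℓ)
open import Algebra.Bundles using (CommutativeRing)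
open import Algebra.Core using (Op₁; Op₂)
open import Algebra.Definitions using (Congruent₁; Congruent₂)
open import Algebra.Structures using (IsCommutativeRing)
import Algebra.Properties.Semiring.Exp as SemiringExp
import Algebra.Properties.CommutativeSemiring.Exp as CommutativeSemiringExp
import Algebra.Solver.Ring.AlmostCommutativeRing as ACR
open import Data.Empty using (⊥; ⊥-elim)
open import Data.Integer as ℤ using (ℤ; +_; -[1+_]; 0ℤ; 1ℤ)
import Data.Integer.Properties as ℤₚ
import Data.Integer.Divisibility.Signed as ℤ∣
open import Data.Integer.Tactic.RingSolver using (solve-∀)
open import Data.List using (List; []; _∷_; length; map)
open import Data.List.Properties using (length-map)
open import Data.Maybe using (Maybe; just; nothing)
open import Data.Nat as ℕ using (ℕ; zero; suc; z≤n; s≤s)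
import Data.Nat.Properties as ℕₚ
open import Data.Nat.Divisibility as ℕ∣ using (_∣_)
open import Data.Nat.Coprimality using (Coprime; coprime-Bézout; coprime-divisor; prime⇒coprime)
open import Data.Nat.GCD using (gcd; gcd[m,n]∣m; gcd[m,n]∣n; module Bézout)
open import Data.Nat.Primality using (Prime; euclidsLemma; prime⇒irreducible; prime⇒nonTrivial)
open import Data.Product using (Σ; ∃-syntax; _×_; _,_; proj₁; proj₂)
open import Data.Sum as Sum using (_⊎_; inj₁; inj₂; [_,_]′)
open import Function using (id)
open import Function.Bundles using (_⇔_; mk⇔)
open import Relation.Binary.Bundles using (Setoid)
open import Relation.Binary.Core using (Rel)
open import Relation.Binary.Definitions using (Tri; tri<; tri≈; tri>)
open import Relation.Binary.PropositionalEquality as ≡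
  using (_≡_; _≢_; refl; cong; cong₂; subst)
open import Relation.Binary.Structures using (IsEquivalence)
import Relation.Binary.Reasoning.Setoid as SetoidReasoning
open import Relation.Nullary using (¬_; Dec; yes; no)

open import Defs

isCommutativeRing-coarsen :
  {A : Set} {_≈_ : Rel A 0ℓ} {_⊕_ _⊗_ : Op₂ A} {⊖_ : Op₁ A} {0# 1# : A} →
  IsEquivalence _≈_ → Congruent₂ _≈_ _⊕_ → Congruent₂ _≈_ _⊗_ → Congruent₁ _≈_ ⊖_ →
  IsCommutativeRing _≡_ _⊕_ _⊗_ ⊖_ 0# 1# → IsCommutativeRing _≈_ _⊕_ _⊗_ ⊖_ 0# 1#
isCommutativeRing-coarsen eqv ⊕-cong ⊗-cong ⊖-cong R = record
  { isRing = record
    { +-isAbelianGroup = record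
      { isGroup = record
        { isMonoid = record
          { isSemigroup = record
            { isMagma = record { isEquivalence = eqv ; ∙-cong = ⊕-cong }
            ; assoc = λ x y z → ≈-reflexive (R.+-assoc x y z) }
          ; identity = (λ x → ≈-reflexive (proj₁ R.+-identity x))
                     , (λ x → ≈-reflexive (proj₂ R.+-identity x)) }
        ; inverse = (λ x → ≈-reflexive (proj₁ R.-‿inverse x))
                  , (λ x → ≈-reflexive (proj₂ R.-‿inverse x))
        ; ⁻¹-cong = ⊖-cong }
      ; comm = λ x y → ≈-reflexive (R.+-comm x y) }
    ; *-cong = ⊗-cong
    ; *-assoc = λ x y z → ≈-reflexive (R.*-assoc x y z)
    ; *-identity = (λ x → ≈-reflexive (proj₁ R.*-identity x))
                 , (λ x → ≈-reflexive (proj₂ R.*-identity x))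
    ; distrib = (λ x y z → ≈-reflexive (proj₁ R.distrib x y z))
              , (λ x y z → ≈-reflexive (proj₂ R.distrib x y z)) }
  ; *-comm = λ x y → ≈-reflexive (R.*-comm x y) }
  where
  module R = IsCommutativeRing R
  open IsEquivalence eqv using () renaming (reflexive to ≈-reflexive)

negE : E → E
negE (u , v) = (ℤ.- u , ℤ.- v)

0E : E
0E = (0ℤ , 0ℤ)

module QuadraticRing (a b : ℤ) where

  open import Data.Integer using (_+_; _*_; -_; _-_)

  private
    _·_ : E → E → E
    _·_ = mulE a b

  ·-assoc : ∀ x y z → (x · y) · z ≡ x · (y · z)
  ·-assoc (u₁ , v₁) (u₂ , v₂) (u₃ , v₃) =
    cong₂ _,_ (constant a b u₁ v₁ u₂ v₂ u₃ v₃) (linear a b u₁ v₁ u₂ v₂ u₃ v₃)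
    where
    constant : ∀ a b u₁ v₁ u₂ v₂ u₃ v₃ →
      (u₁ * u₂ + b * (v₁ * v₂)) * u₃ + b * ((u₁ * v₂ + v₁ * u₂ + a * (v₁ * v₂)) * v₃)
      ≡ u₁ * (u₂ * u₃ + b * (v₂ * v₃)) + b * (v₁ * (u₂ * v₃ + v₂ * u₃ + a * (v₂ * v₃)))
    constant = solve-∀
    linear : ∀ a b u₁ v₁ u₂ v₂ u₃ v₃ →
      (u₁ * u₂ + b * (v₁ * v₂)) * v₃ + (u₁ * v₂ + v₁ * u₂ + a * (v₁ * v₂)) * u₃
        + a * ((u₁ * v₂ + v₁ * u₂ + a * (v₁ * v₂)) * v₃)
      ≡ u₁ * (u₂ * v₃ + v₂ * u₃ + a * (v₂ * v₃)) + v₁ * (u₂ * u₃ + b * (v₂ * v₃))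
        + a * (v₁ * (u₂ * v₃ + v₂ * u₃ + a * (v₂ * v₃)))
    linear = solve-∀

  ·-comm : ∀ x y → x · y ≡ y · x
  ·-comm (u₁ , v₁) (u₂ , v₂) = cong₂ _,_ (constant b u₁ v₁ u₂ v₂) (linear a u₁ v₁ u₂ v₂)
    where
    constant : ∀ b u₁ v₁ u₂ v₂ → u₁ * u₂ + b * (v₁ * v₂) ≡ u₂ * u₁ + b * (v₂ * v₁)
    constant = solve-∀
    linear : ∀ a u₁ v₁ u₂ v₂ →
      u₁ * v₂ + v₁ * u₂ + a * (v₁ * v₂) ≡ u₂ * v₁ + v₂ * u₁ + a * (v₂ * v₁)
    linear = solve-∀

  ·-identityˡ : ∀ x → oneE · x ≡ x
  ·-identityˡ (u , v) = cong₂ _,_ (constant b u v) (linear a u v)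
    where
    constant : ∀ b u v → + 1 * u + b * (+ 0 * v) ≡ u
    constant = solve-∀
    linear : ∀ a u v → + 1 * v + + 0 * u + a * (+ 0 * v) ≡ v
    linear = solve-∀

  ·-identityʳ : ∀ x → x · oneE ≡ x
  ·-identityʳ x = ≡.trans (·-comm x oneE) (·-identityˡ x)

  ·-distribˡ : ∀ x y z → x · addE y z ≡ addE (x · y) (x · z)
  ·-distribˡ (u₁ , v₁) (u₂ , v₂) (u₃ , v₃) =
    cong₂ _,_ (constant b u₁ v₁ u₂ v₂ u₃ v₃) (linear a u₁ v₁ u₂ v₂ u₃ v₃)
    where
    constant : ∀ b u₁ v₁ u₂ v₂ u₃ v₃ →
      u₁ * (u₂ + u₃) + b * (v₁ * (v₂ + v₃))
      ≡ (u₁ * u₂ + b * (v₁ * v₂)) + (u₁ * u₃ + b * (v₁ * v₃))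
    constant = solve-∀
    linear : ∀ a u₁ v₁ u₂ v₂ u₃ v₃ →
      u₁ * (v₂ + v₃) + v₁ * (u₂ + u₃) + a * (v₁ * (v₂ + v₃))
      ≡ (u₁ * v₂ + v₁ * u₂ + a * (v₁ * v₂)) + (u₁ * v₃ + v₁ * u₃ + a * (v₁ * v₃))
    linear = solve-∀

  ·-distribʳ : ∀ x y z → addE y z · x ≡ addE (y · x) (z · x)
  ·-distribʳ x y z = begin
    addE y z · x         ≡⟨ ·-comm (addE y z) x ⟩
    x · addE y z         ≡⟨ ·-distribˡ x y z ⟩
    addE (x · y) (x · z) ≡⟨ cong₂ addE (·-comm x y) (·-comm x z) ⟩
    addE (y · x) (z · x) ∎
    where open ≡.≡-Reasoning

  isCommutativeRing : IsCommutativeRing _≡_ addE (mulE a b) negE 0E oneE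
  isCommutativeRing = record
    { isRing = record
      { +-isAbelianGroup = record
        { isGroup = record
          { isMonoid = record
            { isSemigroup = record
              { isMagma = record { isEquivalence = ≡.isEquivalence ; ∙-cong = cong₂ addE }
              ; assoc = λ { (u₁ , v₁) (u₂ , v₂) (u₃ , v₃) →
                  cong₂ _,_ (ℤₚ.+-assoc u₁ u₂ u₃) (ℤₚ.+-assoc v₁ v₂ v₃) } }
            ; identity = (λ { (u , v) → cong₂ _,_ (ℤₚ.+-identityˡ u) (ℤₚ.+-identityˡ v) })
                       , (λ { (u , v) → cong₂ _,_ (ℤₚ.+-identityʳ u) (ℤₚ.+-identityʳ v) }) }
          ; inverse = (λ { (u , v) → cong₂ _,_ (ℤₚ.+-inverseˡ u) (ℤₚ.+-inverseˡ v) })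
                    , (λ { (u , v) → cong₂ _,_ (ℤₚ.+-inverseʳ u) (ℤₚ.+-inverseʳ v) })
          ; ⁻¹-cong = cong negE }
        ; comm = λ { (u₁ , v₁) (u₂ , v₂) → cong₂ _,_ (ℤₚ.+-comm u₁ u₂) (ℤₚ.+-comm v₁ v₂) } }
      ; *-cong = cong₂ (mulE a b)
      ; *-assoc = ·-assoc
      ; *-identity = ·-identityˡ , ·-identityʳ
      ; distrib = ·-distribˡ , ·-distribʳ }
    ; *-comm = ·-comm }

module _ where

  open import Data.Integer using (_+_; _*_; -_; _-_)

  -- If z² = t z - 1 then zⁿ = α t n + β t n · z; likewise for 2×2 matrices of
  -- determinant 1 and trace t (Cayley–Hamilton).
  mutual
    α : ℤ → ℕ → ℤ
    α t zero    = 1ℤ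
    α t (suc n) = - β t n

    β : ℤ → ℕ → ℤ
    β t zero    = 0ℤ
    β t (suc n) = α t n + t * β t n

  α-β-2 : ∀ n → α (+ 2) n ≡ 1ℤ - + n × β (+ 2) n ≡ + n
  α-β-2 zero = refl , refl
  α-β-2 (suc n) with α-β-2 n
  ... | αₙ , βₙ =
    ≡.trans (cong -_ βₙ) (≡.trans (step-α (+ n)) (cong (λ m → 1ℤ - m) (≡.sym (ℤₚ.pos-+ 1 n)))) ,
    ≡.trans (cong₂ (λ x y → x + + 2 * y) αₙ βₙ) (≡.trans (step-β (+ n)) (≡.sym (ℤₚ.pos-+ 1 n)))
    where
    step-α : ∀ n → - n ≡ 1ℤ - (1ℤ + n)
    step-α = solve-∀
    step-β : ∀ n → (1ℤ - n) + + 2 * n ≡ 1ℤ + n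
    step-β = solve-∀

prime⇒>1 : ∀ {p} → Prime p → 1 ℕ.< p
prime⇒>1 {p} p-prime = ℕ.nonTrivial⇒n>1 p {{prime⇒nonTrivial p-prime}}

module ModPrime (p : ℕ) (p-prime : Prime p) where

  open import Data.Integer using (_+_; _*_; -_; _-_)

  p∣_ : ℤ → Set
  p∣ x = + p ℤ∣.∣ x

  infix 4 _≋_
  record _≋_ (x y : ℤ) : Set where
    constructor mk≋
    field get≋ : p∣ (x - y)
  open _≋_ public

  ≋-via : ∀ {x y} e → x - y ≡ e → p∣ e → x ≋ y
  ≋-via e eq h = mk≋ (subst p∣_ (≡.sym eq) h)

  ≋-refl : ∀ {x} → x ≋ x
  ≋-refl {x} = ≋-via 0ℤ (ℤₚ.+-inverseʳ x) (ℤ∣.divides 0ℤ refl)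

  ≋-reflexive : ∀ {x y} → x ≡ y → x ≋ y
  ≋-reflexive refl = ≋-refl

  ≋-sym : ∀ {x y} → x ≋ y → y ≋ x
  ≋-sym {x} {y} (mk≋ h) = ≋-via _ (swap x y) (ℤ∣.∣m⇒∣-m h)
    where
    swap : ∀ x y → y - x ≡ - (x - y)
    swap = solve-∀

  ≋-trans : ∀ {x y z} → x ≋ y → y ≋ z → x ≋ z
  ≋-trans {x} {y} {z} (mk≋ h) (mk≋ k) = ≋-via _ (split x y z) (ℤ∣.∣m∣n⇒∣m+n h k)
    where
    split : ∀ x y z → x - z ≡ (x - y) + (y - z)
    split = solve-∀

  ≋-isEquivalence : IsEquivalence _≋_
  ≋-isEquivalence = record { refl = ≋-refl ; sym = ≋-sym ; trans = ≋-trans }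

  ≋-setoid : Setoid 0ℓ 0ℓ
  ≋-setoid = record { isEquivalence = ≋-isEquivalence }

  p∣⇒≋0 : ∀ {x} → p∣ x → x ≋ 0ℤ
  p∣⇒≋0 {x} = ≋-via x (ℤₚ.+-identityʳ x)

  ≋0⇒p∣ : ∀ {x} → x ≋ 0ℤ → p∣ x
  ≋0⇒p∣ {x} (mk≋ h) = subst p∣_ (ℤₚ.+-identityʳ x) h

  ≋⇒ModEq : ∀ {x y} → x ≋ y → ModEq p x y
  ≋⇒ModEq (mk≋ h) = ℤ∣.∣⇒∣ᵤ h

  ModEq⇒≋ : ∀ {x y} → ModEq p x y → x ≋ y
  ModEq⇒≋ h = mk≋ (ℤ∣.∣ᵤ⇒∣ h)

  p∣? : ∀ x → Dec (p∣ x)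
  p∣? x = + p ℤ∣.∣? x

  _≋?_ : ∀ x y → Dec (x ≋ y)
  x ≋? y with p∣? (x - y)
  ... | yes h = yes (mk≋ h)
  ... | no ¬h = no (λ e → ¬h (get≋ e))

  +-cong : ∀ {x x′ y y′} → x ≋ x′ → y ≋ y′ → x + y ≋ x′ + y′
  +-cong {x} {x′} {y} {y′} (mk≋ h) (mk≋ k) = ≋-via _ (split x x′ y y′) (ℤ∣.∣m∣n⇒∣m+n h k)
    where
    split : ∀ x x′ y y′ → (x + y) - (x′ + y′) ≡ (x - x′) + (y - y′)
    split = solve-∀

  *-cong : ∀ {x x′ y y′} → x ≋ x′ → y ≋ y′ → x * y ≋ x′ * y′
  *-cong {x} {x′} {y} {y′} (mk≋ h) (mk≋ k) =
    ≋-via _ (split x x′ y y′) (ℤ∣.∣m∣n⇒∣m+n (ℤ∣.∣n⇒∣m*n x k) (ℤ∣.∣m⇒∣m*n y′ h))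
    where
    split : ∀ x x′ y y′ → x * y - x′ * y′ ≡ x * (y - y′) + (x - x′) * y′
    split = solve-∀

  neg-cong : ∀ {x x′} → x ≋ x′ → - x ≋ - x′
  neg-cong {x} {x′} (mk≋ h) = ≋-via _ (split x x′) (ℤ∣.∣m⇒∣-m h)
    where
    split : ∀ x x′ → (- x) - (- x′) ≡ - (x - x′)
    split = solve-∀

  sub-cong : ∀ {x x′ y y′} → x ≋ x′ → y ≋ y′ → x - y ≋ x′ - y′
  sub-cong h k = +-cong h (neg-cong k)

  euclid : ∀ {x y} → p∣ (x * y) → p∣ x ⊎ p∣ y
  euclid {x} {y} h =
    Sum.map ℤ∣.∣ᵤ⇒∣ ℤ∣.∣ᵤ⇒∣ (euclidsLemma ℤ.∣ x ∣ ℤ.∣ y ∣ p-prime (subst (p ∣_) (ℤₚ.abs-* x y) (ℤ∣.∣⇒∣ᵤ h)))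

  p∣square⇒p∣ : ∀ {x} → p∣ (x * x) → p∣ x
  p∣square⇒p∣ h = Sum.reduce (euclid h)

  p∤1 : ¬ p∣ 1ℤ
  p∤1 h = ℕₚ.<⇒≱ (prime⇒>1 p-prime) (ℕ∣.∣⇒≤ (ℤ∣.∣⇒∣ᵤ h))

  p∤⇒coprime : ∀ {n} → ¬ p ∣ n → Coprime p n
  p∤⇒coprime p∤n (d∣p , d∣n) with prime⇒irreducible p-prime d∣p
  ... | inj₁ d≡1 = d≡1
  ... | inj₂ refl = ⊥-elim (p∤n d∣n)

  private
    liftℕ : ∀ m n k l → 1 ℕ.+ m ℕ.* n ≡ k ℕ.* l → 1ℤ + + m * + n ≡ + k * + l
    liftℕ m n k l eq = begin
      1ℤ + + m * + n    ≡⟨ cong (λ w → 1ℤ + w) (ℤₚ.pos-* m n) ⟨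
      + (1 ℕ.+ m ℕ.* n) ≡⟨ cong +_ eq ⟩
      + (k ℕ.* l)       ≡⟨ ℤₚ.pos-* k l ⟩
      + k * + l         ∎
      where open ≡.≡-Reasoning

  inverseℕ : ∀ n → ¬ p ∣ n → ∃[ y ] (+ n * y ≋ 1ℤ)
  inverseℕ n p∤n with coprime-Bézout (p∤⇒coprime p∤n)
  ... | Bézout.+- x y eq = - + y , ≋-via (+ p * - + x) difference (ℤ∣.∣m⇒∣m*n (- + x) ℤ∣.∣-refl)
    where
    difference : + n * - + y - 1ℤ ≡ + p * - + x
    difference = begin
      + n * - + y - 1ℤ    ≡⟨ negate (+ n) (+ y) ⟩
      - (1ℤ + + y * + n)  ≡⟨ cong -_ (liftℕ y n x p eq) ⟩
      - (+ x * + p)       ≡⟨ commute (+ x) (+ p) ⟩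
      + p * - + x         ∎
      where
      open ≡.≡-Reasoning
      negate : ∀ n y → n * - y - 1ℤ ≡ - (1ℤ + y * n)
      negate = solve-∀
      commute : ∀ x p → - (x * p) ≡ p * - x
      commute = solve-∀
  ... | Bézout.-+ x y eq = + y , ≋-via (+ p * + x) difference (ℤ∣.∣m⇒∣m*n (+ x) ℤ∣.∣-refl)
    where
    difference : + n * + y - 1ℤ ≡ + p * + x
    difference = begin
      + n * + y - 1ℤ           ≡⟨ cong (_- 1ℤ) (ℤₚ.*-comm (+ n) (+ y)) ⟩
      + y * + n - 1ℤ           ≡⟨ cong (_- 1ℤ) (liftℕ x p y n eq) ⟨
      1ℤ + + x * + p - 1ℤ      ≡⟨ cancel (+ x) (+ p) ⟩
      + p * + x                ∎
      where
      open ≡.≡-Reasoning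
      cancel : ∀ x p → 1ℤ + x * p - 1ℤ ≡ p * x
      cancel = solve-∀

  inverse : ∀ x → ¬ p∣ x → ∃[ y ] (x * y ≋ 1ℤ)
  inverse (+ n) p∤x = inverseℕ n (λ p∣n → p∤x (ℤ∣.∣ᵤ⇒∣ p∣n))
  inverse -[1+ n ] p∤x with inverseℕ (suc n) (λ p∣n → p∤x (ℤ∣.∣m⇒∣-m (ℤ∣.∣ᵤ⇒∣ p∣n)))
  ... | y , ny≋1 = - y , ≋-trans (≋-reflexive (negate (+ suc n) y)) ny≋1
    where
    negate : ∀ m y → (- m) * (- y) ≡ m * y
    negate = solve-∀

  module ≋-Reasoning = SetoidReasoning ≋-setoid

  α-β-cong : ∀ {t t′} → t ≋ t′ → ∀ n → α t n ≋ α t′ n × β t n ≋ β t′ n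
  α-β-cong t≋t′ zero = ≋-refl , ≋-refl
  α-β-cong t≋t′ (suc n) with α-β-cong t≋t′ n
  ... | αₙ , βₙ = neg-cong βₙ , +-cong αₙ (*-cong t≋t′ βₙ)

module QuadraticField (p : ℕ) (p-prime : Prime p) (a b : ℤ) (irreducible : Irreducible p a b) where

  open import Data.Integer using (_+_; _*_; -_; _-_)

  open ModPrime p p-prime

  infixr 8 _^_
  infixl 7 _·_
  infixl 6 _⊕_
  infix 4 _≈_

  _·_ : E → E → E
  _·_ = mulE a b

  _⊕_ : E → E → E
  _⊕_ = addE

  _^_ : E → ℕ → E
  _^_ = powE a b

  ι : ℤ → E
  ι c = (c , 0ℤ)

  record _≈_ (x y : E) : Set where
    constructor _&_
    field
      ≈₁ : proj₁ x ≋ proj₁ y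
      ≈₂ : proj₂ x ≋ proj₂ y
  open _≈_ public

  ≈-refl : ∀ {x} → x ≈ x
  ≈-refl = ≋-refl & ≋-refl

  ≈-reflexive : ∀ {x y} → x ≡ y → x ≈ y
  ≈-reflexive refl = ≈-refl

  ≈-sym : ∀ {x y} → x ≈ y → y ≈ x
  ≈-sym (h & k) = ≋-sym h & ≋-sym k

  ≈-trans : ∀ {x y z} → x ≈ y → y ≈ z → x ≈ z
  ≈-trans (h & k) (h′ & k′) = ≋-trans h h′ & ≋-trans k k′

  ≈-isEquivalence : IsEquivalence _≈_
  ≈-isEquivalence = record { refl = ≈-refl ; sym = ≈-sym ; trans = ≈-trans }

  ⊕-cong : ∀ {x x′ y y′} → x ≈ x′ → y ≈ y′ → x ⊕ y ≈ x′ ⊕ y′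
  ⊕-cong (h & k) (h′ & k′) = +-cong h h′ & +-cong k k′

  negE-cong : ∀ {x x′} → x ≈ x′ → negE x ≈ negE x′
  negE-cong (h & k) = neg-cong h & neg-cong k

  ·-cong : ∀ {x x′ y y′} → x ≈ x′ → y ≈ y′ → x · y ≈ x′ · y′
  ·-cong (h & k) (h′ & k′) =
    +-cong (*-cong h h′) (*-cong (≋-refl {b}) (*-cong k k′)) &
    +-cong (+-cong (*-cong h k′) (*-cong k h′)) (*-cong (≋-refl {a}) (*-cong k k′))

  ring : CommutativeRing 0ℓ 0ℓ
  ring = record
    { isCommutativeRing = isCommutativeRing-coarsen ≈-isEquivalence ⊕-cong ·-cong negE-cong
                            (QuadraticRing.isCommutativeRing a b) }

  private
    module R = CommutativeRing ring

  module ≈-Reasoning = SetoidReasoning R.setoid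

  ≈⇒≈E : ∀ {x y} → x ≈ y → x ≈E[ p ] y
  ≈⇒≈E (h & k) = ≋⇒ModEq h , ≋⇒ModEq k

  ≈E⇒≈ : ∀ {x y} → x ≈E[ p ] y → x ≈ y
  ≈E⇒≈ (h , k) = ModEq⇒≋ h & ModEq⇒≋ k

  _≈?_ : ∀ x y → Dec (x ≈ y)
  x ≈? y with proj₁ x ≋? proj₁ y | proj₂ x ≋? proj₂ y
  ... | yes h | yes k = yes (h & k)
  ... | no ¬h | _     = no (λ e → ¬h (≈₁ e))
  ... | _     | no ¬k = no (λ e → ¬k (≈₂ e))

  ι-cong : ∀ {x y} → x ≋ y → ι x ≈ ι y
  ι-cong h = h & ≋-refl

  ι-* : ∀ x y → ι (x * y) ≡ ι x · ι y
  ι-* x y = ≡.sym (cong₂ _,_ (constant b x y) (linear a x y))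
    where
    constant : ∀ b x y → x * y + b * (+ 0 * + 0) ≡ x * y
    constant = solve-∀
    linear : ∀ a x y → x * + 0 + + 0 * y + a * (+ 0 * + 0) ≡ + 0
    linear = solve-∀

  module Solver where
    private
      almostRing : ACR.AlmostCommutativeRing 0ℓ 0ℓ
      almostRing = ACR.fromCommutativeRing ring

      ι-morphism : CommutativeRing.rawRing ℤₚ.+-*-commutativeRing ACR.-Raw-AlmostCommutative⟶ almostRing
      ι-morphism = record
        { ⟦_⟧ = ι
        ; +-homo = λ _ _ → ≈-refl
        ; *-homo = λ x y → ≈-reflexive (ι-* x y)
        ; -‿homo = λ _ → ≈-refl
        ; 0-homo = ≈-refl
        ; 1-homo = ≈-refl }

      ι-equal? : ∀ x y → Maybe (ι x ≈ ι y)
      ι-equal? x y with x ℤ.≟ y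
      ... | yes refl = just ≈-refl
      ... | no _     = nothing

    open import Algebra.Solver.Ring (CommutativeRing.rawRing ℤₚ.+-*-commutativeRing)
                                    almostRing ι-morphism ι-equal? public

  open Solver using (solve; _:+_; _:*_; _:-_; :-_; _:=_; con)

  ≈0⇒≈ : ∀ {x y} → x ⊕ negE y ≈ 0E → x ≈ y
  ≈0⇒≈ {x} {y} h = begin
    x                 ≈⟨ solve 2 (λ x y → x := (x :- y) :+ y) ≈-refl x y ⟩
    (x ⊕ negE y) ⊕ y  ≈⟨ ⊕-cong h (≈-refl {y}) ⟩
    0E ⊕ y            ≈⟨ R.+-identityˡ y ⟩
    y                 ∎
    where open ≈-Reasoning

  ≈⇒≈0 : ∀ {x y} → x ≈ y → x ⊕ negE y ≈ 0E
  ≈⇒≈0 {y = y} h = ≈-trans (⊕-cong h (≈-refl {negE y})) (R.-‿inverseʳ y)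

  1≉0 : ¬ (oneE ≈ 0E)
  1≉0 h = p∤1 (≋0⇒p∣ (≈₁ h))

  norm : E → ℤ
  norm (u , v) = u * u + a * (u * v) - b * (v * v)

  norm-· : ∀ x y → norm (x · y) ≡ norm x * norm y
  norm-· (u₁ , v₁) (u₂ , v₂) = multiplicative a b u₁ v₁ u₂ v₂
    where
    multiplicative : ∀ a b u₁ v₁ u₂ v₂ →
      (u₁ * u₂ + b * (v₁ * v₂)) * (u₁ * u₂ + b * (v₁ * v₂))
        + a * ((u₁ * u₂ + b * (v₁ * v₂)) * (u₁ * v₂ + v₁ * u₂ + a * (v₁ * v₂)))
        - b * ((u₁ * v₂ + v₁ * u₂ + a * (v₁ * v₂)) * (u₁ * v₂ + v₁ * u₂ + a * (v₁ * v₂)))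
      ≡ (u₁ * u₁ + a * (u₁ * v₁) - b * (v₁ * v₁)) * (u₂ * u₂ + a * (u₂ * v₂) - b * (v₂ * v₂))
    multiplicative = solve-∀

  norm-oneE : norm oneE ≡ 1ℤ
  norm-oneE = expand a b
    where
    expand : ∀ a b → + 1 * + 1 + a * (+ 1 * + 0) - b * (+ 0 * + 0) ≡ 1ℤ
    expand = solve-∀

  norm-cong : ∀ {x y} → x ≈ y → norm x ≋ norm y
  norm-cong (h & k) =
    sub-cong (+-cong (*-cong h h) (*-cong (≋-refl {a}) (*-cong h k))) (*-cong (≋-refl {b}) (*-cong k k))

  -- Only 0 has norm 0, since x² - a x - b has no root mod p.
  norm≋0⇒≈0 : ∀ x → norm x ≋ 0ℤ → x ≈ 0E
  norm≋0⇒≈0 (u , v) norm≋0 with p∣? v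
  ... | yes p∣v = p∣⇒≋0 (p∣square⇒p∣ (≋0⇒p∣ u²≋0)) & p∣⇒≋0 p∣v
    where
    u²≋0 : u * u ≋ 0ℤ
    u²≋0 = begin
      u * u     ≈⟨ ≋-via (v * (a * u - b * v)) (norm-u² a b u v) (ℤ∣.∣m⇒∣m*n (a * u - b * v) p∣v) ⟨
      norm (u , v) ≈⟨ norm≋0 ⟩
      0ℤ        ∎
      where
      open ≋-Reasoning
      norm-u² : ∀ a b u v → u * u + a * (u * v) - b * (v * v) - u * u ≡ v * (a * u - b * v)
      norm-u² = solve-∀
  ... | no p∤v = ⊥-elim (irreducible r (≋⇒ModEq root))
    where
    w = proj₁ (inverse v p∤v)
    r = - (u * w)
    -- r = -u/v is a root of x² - a x - b, because v⁻² · norm (u , v) is its value there.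
    root : r * r - a * r - b ≋ 0ℤ
    root = begin
      r * r - a * r - b
        ≈⟨ ≋-reflexive (expand a b u v w) ⟩
      w * w * norm (u , v) + (1ℤ - v * w) * (a * u * w - b * (1ℤ + v * w))
        ≈⟨ +-cong (*-cong (≋-refl {w * w}) norm≋0)
                  (*-cong (sub-cong (≋-refl {1ℤ}) (proj₂ (inverse v p∤v))) (≋-refl {a * u * w - b * (1ℤ + v * w)})) ⟩
      w * w * 0ℤ + (1ℤ - 1ℤ) * (a * u * w - b * (1ℤ + v * w))
        ≈⟨ ≋-reflexive (vanish (w * w) (a * u * w - b * (1ℤ + v * w))) ⟩
      0ℤ ∎
      where
      open ≋-Reasoning
      expand : ∀ a b u v w → (- (u * w)) * (- (u * w)) - a * (- (u * w)) - b
        ≡ w * w * (u * u + a * (u * v) - b * (v * v)) + (1ℤ - v * w) * (a * u * w - b * (1ℤ + v * w))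
      expand = solve-∀
      vanish : ∀ x y → x * 0ℤ + (1ℤ - 1ℤ) * y ≡ 0ℤ
      vanish = solve-∀

  x·y≈0⇒x≈0∨y≈0 : ∀ {x y} → x · y ≈ 0E → x ≈ 0E ⊎ y ≈ 0E
  x·y≈0⇒x≈0∨y≈0 {x} {y} xy≈0 with euclid (≋0⇒p∣ normx*normy≋0)
    where
    normx*normy≋0 : norm x * norm y ≋ 0ℤ
    normx*normy≋0 = ≋-trans (≋-reflexive (≡.sym (norm-· x y)))
                      (≋-trans (norm-cong xy≈0) (≋-reflexive (norm-0 a b)))
      where
      norm-0 : ∀ a b → 0ℤ * 0ℤ + a * (0ℤ * 0ℤ) - b * (0ℤ * 0ℤ) ≡ 0ℤ
      norm-0 = solve-∀
  ... | inj₁ p∣Nx = inj₁ (norm≋0⇒≈0 x (p∣⇒≋0 p∣Nx))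
  ... | inj₂ p∣Ny = inj₂ (norm≋0⇒≈0 y (p∣⇒≋0 p∣Ny))

  ·-cancelˡ : ∀ {c x y} → ¬ (c ≈ 0E) → c · x ≈ c · y → x ≈ y
  ·-cancelˡ {c} {x} {y} c≉0 cx≈cy = [ (λ c≈0 → ⊥-elim (c≉0 c≈0)) , ≈0⇒≈ ]′ (x·y≈0⇒x≈0∨y≈0 c[x-y]≈0)
    where
    c[x-y]≈0 : c · (x ⊕ negE y) ≈ 0E
    c[x-y]≈0 = ≈-trans (solve 3 (λ c x y → c :* (x :- y) := c :* x :- c :* y) ≈-refl c x y) (≈⇒≈0 cx≈cy)

  private
    module Exp = SemiringExp R.semiring
    module CommExp = CommutativeSemiringExp R.commutativeSemiring

  ^≡Exp^ : ∀ x n → x ^ n ≡ x Exp.^ n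
  ^≡Exp^ x zero = refl
  ^≡Exp^ x (suc n) = cong (x ·_) (^≡Exp^ x n)

  ^-+ : ∀ x m n → x ^ (m ℕ.+ n) ≈ x ^ m · x ^ n
  ^-+ x m n rewrite ^≡Exp^ x (m ℕ.+ n) | ^≡Exp^ x m | ^≡Exp^ x n = Exp.^-homo-* x m n

  ^-* : ∀ x m n → (x ^ m) ^ n ≈ x ^ (m ℕ.* n)
  ^-* x m n rewrite ^≡Exp^ (x ^ m) n | ^≡Exp^ x m | ^≡Exp^ x (m ℕ.* n) = Exp.^-assocʳ x m n

  ^-cong : ∀ n {x y} → x ≈ y → x ^ n ≈ y ^ n
  ^-cong n {x} {y} h rewrite ^≡Exp^ x n | ^≡Exp^ y n = Exp.^-congˡ n h

  ^-distrib-· : ∀ x y n → (x · y) ^ n ≈ x ^ n · y ^ n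
  ^-distrib-· x y n rewrite ^≡Exp^ (x · y) n | ^≡Exp^ x n | ^≡Exp^ y n = CommExp.^-distrib-* x y n

  ^-comm : ∀ x m n → (x ^ m) ^ n ≈ (x ^ n) ^ m
  ^-comm x m n = ≈-trans (^-* x m n) (≈-trans (≈-reflexive (cong (x ^_) (ℕₚ.*-comm m n))) (≈-sym (^-* x n m)))

  1^ : ∀ n → oneE ^ n ≈ oneE
  1^ zero = ≈-refl
  1^ (suc n) = ≈-trans (·-cong (≈-refl {oneE}) (1^ n)) (R.*-identityˡ oneE)

  0^suc : ∀ n → 0E ^ suc n ≈ 0E
  0^suc n = R.zeroˡ (0E ^ n)

  ι-^ : ∀ c n → ι c ^ n ≈ ι (c ℤ.^ n)
  ι-^ c zero = ≈-refl
  ι-^ c (suc n) = ≈-trans (·-cong (≈-refl {ι c}) (ι-^ c n)) (≈-reflexive (≡.sym (ι-* c (c ℤ.^ n))))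

  norm-^ : ∀ x n → norm (x ^ n) ≋ norm x ℤ.^ n
  norm-^ x zero = ≋-reflexive norm-oneE
  norm-^ x (suc n) = ≋-trans (≋-reflexive (norm-· x (x ^ n))) (*-cong (≋-refl {norm x}) (norm-^ x n))

  record _∈𝔽ₚ (x : E) : Set where
    constructor in𝔽ₚ
    field coefficient-vanishes : p∣ (proj₂ x)
  open _∈𝔽ₚ public

  ∈𝔽ₚ-resp-≈ : ∀ {x y} → x ≈ y → x ∈𝔽ₚ → y ∈𝔽ₚ
  ∈𝔽ₚ-resp-≈ e (in𝔽ₚ h) = in𝔽ₚ (≋0⇒p∣ (≋-trans (≋-sym (≈₂ e)) (p∣⇒≋0 h)))

  ι-∈𝔽ₚ : ∀ c → ι c ∈𝔽ₚ
  ι-∈𝔽ₚ c = in𝔽ₚ (ℤ∣.divides 0ℤ refl)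

  ⊕-∈𝔽ₚ : ∀ {x y} → x ∈𝔽ₚ → y ∈𝔽ₚ → (x ⊕ y) ∈𝔽ₚ
  ⊕-∈𝔽ₚ (in𝔽ₚ h) (in𝔽ₚ k) = in𝔽ₚ (ℤ∣.∣m∣n⇒∣m+n h k)

  negE-∈𝔽ₚ : ∀ {x} → x ∈𝔽ₚ → negE x ∈𝔽ₚ
  negE-∈𝔽ₚ (in𝔽ₚ h) = in𝔽ₚ (ℤ∣.∣m⇒∣-m h)

  ·-∈𝔽ₚ : ∀ {x y} → x ∈𝔽ₚ → y ∈𝔽ₚ → (x · y) ∈𝔽ₚ
  ·-∈𝔽ₚ {u₁ , v₁} {u₂ , v₂} (in𝔽ₚ h) (in𝔽ₚ k) =
    in𝔽ₚ (ℤ∣.∣m∣n⇒∣m+n (ℤ∣.∣m∣n⇒∣m+n (ℤ∣.∣n⇒∣m*n u₁ k) (ℤ∣.∣m⇒∣m*n u₂ h)) (ℤ∣.∣n⇒∣m*n a (ℤ∣.∣n⇒∣m*n v₁ k)))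

  ^-∈𝔽ₚ : ∀ {x} n → x ∈𝔽ₚ → (x ^ n) ∈𝔽ₚ
  ^-∈𝔽ₚ zero h = ι-∈𝔽ₚ 1ℤ
  ^-∈𝔽ₚ (suc n) h = ·-∈𝔽ₚ h (^-∈𝔽ₚ n h)

  ι·∈𝔽ₚ⇒p∣ : ∀ c z → (ι c · z) ∈𝔽ₚ → p∣ (c * proj₂ z)
  ι·∈𝔽ₚ⇒p∣ c (u , v) (in𝔽ₚ h) = subst p∣_ (coefficient a c u v) h
    where
    coefficient : ∀ a c u v → c * v + + 0 * u + a * (+ 0 * v) ≡ c * v
    coefficient = solve-∀

  ·≈1⇒∈𝔽ₚ : ∀ {c z} → c ∈𝔽ₚ → c · z ≈ oneE → z ∈𝔽ₚ
  ·≈1⇒∈𝔽ₚ {c₁ , c₂} {z₁ , z₂} (in𝔽ₚ p∣c₂) cz≈1 = in𝔽ₚ ([ (λ p∣c₁ → ⊥-elim (p∤c₁ p∣c₁)) , id ]′ (euclid p∣c₁z₂))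
    where
    p∣c₁z₂ : p∣ (c₁ * z₂)
    p∣c₁z₂ = ≋0⇒p∣ (begin
      c₁ * z₂
        ≈⟨ ≋-reflexive (ℤₚ.+-identityʳ (c₁ * z₂)) ⟨
      c₁ * z₂ + 0ℤ
        ≈⟨ +-cong (≋-refl {c₁ * z₂}) (p∣⇒≋0 (ℤ∣.∣m⇒∣m*n (z₁ + a * z₂) p∣c₂)) ⟨
      c₁ * z₂ + c₂ * (z₁ + a * z₂)
        ≈⟨ ≋-reflexive (regroup a c₁ c₂ z₁ z₂) ⟨
      c₁ * z₂ + c₂ * z₁ + a * (c₂ * z₂)
        ≈⟨ ≈₂ cz≈1 ⟩
      0ℤ                                     ∎)
      where
      open ≋-Reasoning
      regroup : ∀ a c₁ c₂ z₁ z₂ → c₁ * z₂ + c₂ * z₁ + a * (c₂ * z₂) ≡ c₁ * z₂ + c₂ * (z₁ + a * z₂)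
      regroup = solve-∀
    p∤c₁ : ¬ p∣ c₁
    p∤c₁ p∣c₁ = 1≉0 (begin
      oneE                ≈⟨ cz≈1 ⟨
      (c₁ , c₂) · (z₁ , z₂) ≈⟨ ·-cong (p∣⇒≋0 p∣c₁ & p∣⇒≋0 p∣c₂) (≈-refl {z₁ , z₂}) ⟩
      0E · (z₁ , z₂)      ≈⟨ R.zeroˡ (z₁ , z₂) ⟩
      0E                  ∎)
      where open ≈-Reasoning

  ∉𝔽ₚ-cancel : ∀ {z c} → ¬ z ∈𝔽ₚ → p∣ (c * proj₂ z) → p∣ c
  ∉𝔽ₚ-cancel z∉𝔽ₚ p∣cv = [ id , (λ q → ⊥-elim (z∉𝔽ₚ (in𝔽ₚ q))) ]′ (euclid p∣cv)

  coordinates-of-1 : ∀ {c d z} → ¬ z ∈𝔽ₚ → ι c ⊕ ι d · z ≈ oneE → c ≋ 1ℤ × d ≋ 0ℤ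
  coordinates-of-1 {c} {d} {u , v} z∉𝔽ₚ (h₁ & h₂) = c≋1 , p∣⇒≋0 p∣d
    where
    p∣d : p∣ d
    p∣d = ∉𝔽ₚ-cancel z∉𝔽ₚ (≋0⇒p∣ (≋-trans (≋-reflexive (≡.sym (linear a d u v))) h₂))
      where
      linear : ∀ a d u v → 0ℤ + (d * v + + 0 * u + a * (+ 0 * v)) ≡ d * v
      linear = solve-∀
    c≋1 : c ≋ 1ℤ
    c≋1 = begin
      c                              ≈⟨ ≋-reflexive (ℤₚ.+-identityʳ c) ⟨
      c + 0ℤ                         ≈⟨ +-cong (≋-refl {c}) (p∣⇒≋0 (ℤ∣.∣m⇒∣m*n u p∣d)) ⟨
      c + d * u                      ≈⟨ ≋-reflexive (cong (λ w → c + w) (constant b d u v)) ⟨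
      c + (d * u + b * (+ 0 * v))    ≈⟨ h₁ ⟩
      1ℤ                             ∎
      where
      open ≋-Reasoning
      constant : ∀ b d u v → d * u + b * (+ 0 * v) ≡ d * u
      constant = solve-∀

  conj : E → E
  conj (u , v) = (u + a * v , - v)

  ·-conj : ∀ x → x · conj x ≈ ι (norm x)
  ·-conj (u , v) = ≋-reflexive (constant a b u v) & ≋-reflexive (linear a u v)
    where
    constant : ∀ a b u v → u * (u + a * v) + b * (v * (- v)) ≡ u * u + a * (u * v) - b * (v * v)
    constant = solve-∀
    linear : ∀ a u v → u * (- v) + v * (u + a * v) + a * (v * (- v)) ≡ 0ℤ
    linear = solve-∀

  -- Polynomials over E, as coefficient lists with the constant term first

  eval : List E → E → E
  eval []       y = 0E
  eval (c ∷ cs) y = c ⊕ y · eval cs y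

  eval-map-· : ∀ e cs y → e · eval cs y ≈ eval (map (e ·_) cs) y
  eval-map-· e []       y = R.zeroʳ e
  eval-map-· e (c ∷ cs) y = ≈-trans
    (solve 4 (λ e c y ev → e :* (c :+ y :* ev) := e :* c :+ y :* (e :* ev)) ≈-refl e c y (eval cs y))
    (⊕-cong (≈-refl {e · c}) (·-cong (≈-refl {y}) (eval-map-· e cs y)))

  powers : E → ℕ → List E
  powers c zero    = []
  powers c (suc n) = oneE ∷ map (c ·_) (powers c n)

  length-powers : ∀ c n → length (powers c n) ≡ n
  length-powers c zero    = refl
  length-powers c (suc n) = cong suc (≡.trans (length-map (c ·_) (powers c n)) (length-powers c n))

  geometric-sum : ∀ c y n → (c · y ⊕ negE oneE) · eval (powers c n) y ≈ (c · y) ^ n ⊕ negE oneE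
  geometric-sum c y zero = ≈-trans (R.zeroʳ (c · y ⊕ negE oneE)) (≈-sym (R.-‿inverseʳ oneE))
  geometric-sum c y (suc n) = begin
    (c · y ⊕ negE oneE) · (oneE ⊕ y · eval (map (c ·_) (powers c n)) y)
      ≈⟨ ·-cong (≈-refl {c · y ⊕ negE oneE})
                (⊕-cong (≈-refl {oneE}) (·-cong (≈-refl {y}) (≈-sym (eval-map-· c (powers c n) y)))) ⟩
    (c · y ⊕ negE oneE) · (oneE ⊕ y · (c · S))
      ≈⟨ solve 3 (λ c y S → (c :* y :- con 1ℤ) :* (con 1ℤ :+ y :* (c :* S))
                           := (c :* y :- con 1ℤ) :+ (c :* y) :* ((c :* y :- con 1ℤ) :* S)) ≈-refl c y S ⟩
    (c · y ⊕ negE oneE) ⊕ (c · y) · ((c · y ⊕ negE oneE) · S)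
      ≈⟨ ⊕-cong (≈-refl {c · y ⊕ negE oneE}) (·-cong (≈-refl {c · y}) (geometric-sum c y n)) ⟩
    (c · y ⊕ negE oneE) ⊕ (c · y) · ((c · y) ^ n ⊕ negE oneE)
      ≈⟨ solve 2 (λ w X → (w :- con 1ℤ) :+ w :* (X :- con 1ℤ) := w :* X :- con 1ℤ) ≈-refl (c · y) ((c · y) ^ n) ⟩
    (c · y) ^ suc n ⊕ negE oneE ∎
    where
    open ≈-Reasoning
    S = eval (powers c n) y

  quadratic : ℤ → E → E
  quadratic t y = y · y ⊕ negE (ι t · y) ⊕ oneE

  quotient : ℤ → ℕ → List E
  quotient t zero    = []
  quotient t (suc n) = ι (β t n) ∷ quotient t n

  length-quotient : ∀ t n → length (quotient t n) ≡ n
  length-quotient t zero    = refl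
  length-quotient t (suc n) = cong suc (length-quotient t n)

  ^-divMod-quadratic : ∀ t y n → y ^ n ≈ ι (α t n) ⊕ ι (β t n) · y ⊕ quadratic t y · eval (quotient t n) y
  ^-divMod-quadratic t y zero =
    solve 2 (λ y f → con 1ℤ := con 1ℤ :+ con 0ℤ :* y :+ f :* con 0ℤ) ≈-refl y (quadratic t y)
  ^-divMod-quadratic t y (suc n) = begin
    y · y ^ n
      ≈⟨ ·-cong (≈-refl {y}) (^-divMod-quadratic t y n) ⟩
    y · (A ⊕ B · y ⊕ quadratic t y · Q)
      ≈⟨ solve 5 (λ y A B T Q → y :* (A :+ B :* y :+ (y :* y :- T :* y :+ con 1ℤ) :* Q)
                              := :- B :+ (A :+ T :* B) :* y :+ (y :* y :- T :* y :+ con 1ℤ) :* (B :+ y :* Q))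
           ≈-refl y A B (ι t) Q ⟩
    negE B ⊕ (A ⊕ ι t · B) · y ⊕ quadratic t y · (B ⊕ y · Q)
      ≈⟨ ⊕-cong (⊕-cong (≈-refl {negE B}) (·-cong (⊕-cong (≈-refl {A}) (≈-reflexive (≡.sym (ι-* t (β t n))))) (≈-refl {y})))
                (≈-refl {quadratic t y · (B ⊕ y · Q)}) ⟩
    ι (α t (suc n)) ⊕ ι (β t (suc n)) · y ⊕ quadratic t y · eval (quotient t (suc n)) y ∎
    where
    open ≈-Reasoning
    A = ι (α t n)
    B = ι (β t n)
    Q = eval (quotient t n) y

  ^-root-of-quadratic : ∀ {t z} → quadratic t z ≈ 0E → ∀ n → z ^ n ≈ ι (α t n) ⊕ ι (β t n) · z
  ^-root-of-quadratic {t} {z} fz≈0 n = begin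
    z ^ n
      ≈⟨ ^-divMod-quadratic t z n ⟩
    ι (α t n) ⊕ ι (β t n) · z ⊕ quadratic t z · eval (quotient t n) z
      ≈⟨ ⊕-cong (≈-refl {ι (α t n) ⊕ ι (β t n) · z}) (·-cong fz≈0 (≈-refl {eval (quotient t n) z})) ⟩
    ι (α t n) ⊕ ι (β t n) · z ⊕ 0E · eval (quotient t n) z
      ≈⟨ ⊕-cong (≈-refl {ι (α t n) ⊕ ι (β t n) · z}) (R.zeroˡ (eval (quotient t n) z)) ⟩
    ι (α t n) ⊕ ι (β t n) · z ⊕ 0E
      ≈⟨ R.+-identityʳ (ι (α t n) ⊕ ι (β t n) · z) ⟩
    ι (α t n) ⊕ ι (β t n) · z                                        ∎
    where open ≈-Reasoning

  -- (y z - x)(y z + x - t y) = y² (z² - t z + 1) - (x² - t x y + y²), so y z ∈ 𝔽_p and y = 0.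
  anisotropic : ∀ t z → ¬ z ∈𝔽ₚ → quadratic t z ≈ 0E →
                ∀ x y → x * x - t * x * y + y * y ≋ 0ℤ → p∣ x × p∣ y
  anisotropic t z z∉𝔽ₚ fz≈0 x y form≋0 = p∣x , p∣y
    where
    X = ι x
    Y = ι y
    T = ι t
    form : X · X ⊕ negE (T · X · Y) ⊕ Y · Y ≈ 0E
    form = ≈-trans (≈-sym (≈-reflexive (cong₂ addE (cong₂ addE (ι-* x x) (cong negE (≡.trans (ι-* (t * x) y)
                     (cong (_· Y) (ι-* t x))))) (ι-* y y)))) (ι-cong form≋0)
    factorisation : (Y · z ⊕ negE X) · (Y · z ⊕ X ⊕ negE (T · Y)) ≈ 0E
    factorisation = begin
      (Y · z ⊕ negE X) · (Y · z ⊕ X ⊕ negE (T · Y))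
        ≈⟨ solve 4 (λ X Y T z → (Y :* z :- X) :* (Y :* z :+ X :- T :* Y)
                              := Y :* Y :* (z :* z :- T :* z :+ con 1ℤ) :- (X :* X :- T :* X :* Y :+ Y :* Y))
             ≈-refl X Y T z ⟩
      Y · Y · quadratic t z ⊕ negE (X · X ⊕ negE (T · X · Y) ⊕ Y · Y)
        ≈⟨ ⊕-cong (·-cong (≈-refl {Y · Y}) fz≈0) (negE-cong form) ⟩
      Y · Y · 0E ⊕ negE 0E
        ≈⟨ solve 1 (λ Y → Y :* Y :* con 0ℤ :- con 0ℤ := con 0ℤ) ≈-refl Y ⟩
      0E ∎
      where open ≈-Reasoning
    Yz∈𝔽ₚ : (Y · z) ∈𝔽ₚ
    Yz∈𝔽ₚ = [ (λ Yz-X≈0 → ∈𝔽ₚ-resp-≈ (≈-sym (≈0⇒≈ Yz-X≈0)) (ι-∈𝔽ₚ x))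
            , (λ Yz+X-TY≈0 → ∈𝔽ₚ-resp-≈ (≈-sym (Yz≈TY-X Yz+X-TY≈0)) (⊕-∈𝔽ₚ (ι-∈𝔽ₚ (t * y)) (negE-∈𝔽ₚ (ι-∈𝔽ₚ x))))
            ]′ (x·y≈0⇒x≈0∨y≈0 factorisation)
      where
      Yz≈TY-X : Y · z ⊕ X ⊕ negE (T · Y) ≈ 0E → Y · z ≈ ι (t * y) ⊕ negE X
      Yz≈TY-X Yz+X-TY≈0 = begin
        Y · z
          ≈⟨ solve 4 (λ X Y T z → Y :* z := (Y :* z :+ X :- T :* Y) :+ (T :* Y :- X)) ≈-refl X Y T z ⟩
        (Y · z ⊕ X ⊕ negE (T · Y)) ⊕ (T · Y ⊕ negE X)
          ≈⟨ ⊕-cong Yz+X-TY≈0 (≈-refl {T · Y ⊕ negE X}) ⟩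
        0E ⊕ (T · Y ⊕ negE X)
          ≈⟨ R.+-identityˡ (T · Y ⊕ negE X) ⟩
        T · Y ⊕ negE X
          ≈⟨ ≈-reflexive (cong (_⊕ negE X) (≡.sym (ι-* t y))) ⟩
        ι (t * y) ⊕ negE X                             ∎
        where open ≈-Reasoning
    p∣y : p∣ y
    p∣y = ∉𝔽ₚ-cancel z∉𝔽ₚ (ι·∈𝔽ₚ⇒p∣ y z Yz∈𝔽ₚ)
    p∣x : p∣ x
    p∣x = p∣square⇒p∣ (≋0⇒p∣ (begin
      x * x                    ≈⟨ ≋-via (y * (y - t * x)) (cancel x t y) (ℤ∣.∣m⇒∣m*n (y - t * x) p∣y) ⟨
      x * x - t * x * y + y * y ≈⟨ form≋0 ⟩
      0ℤ                       ∎))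
      where
      open ≋-Reasoning
      cancel : ∀ x t y → x * x - t * x * y + y * y - x * x ≡ y * (y - t * x)
      cancel = solve-∀

module Matrices (p : ℕ) (p-prime : Prime p) where

  open import Data.Integer using (_+_; _*_; -_; _-_)

  open ModPrime p p-prime

  infix 4 _≈V_ _≈M_

  record _≈V_ (v w : V2) : Set where
    constructor _&V_
    field
      ≈V₁ : proj₁ v ≋ proj₁ w
      ≈V₂ : proj₂ v ≋ proj₂ w
  open _≈V_ public

  record _≈M_ (A B : M2) : Set where
    constructor _&M_
    field
      row₁ : proj₁ A ≈V proj₁ B
      row₂ : proj₂ A ≈V proj₂ B
  open _≈M_ public

  ≈V-refl : ∀ {v} → v ≈V v
  ≈V-refl = ≋-refl &V ≋-refl

  ≈V-reflexive : ∀ {v w} → v ≡ w → v ≈V w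
  ≈V-reflexive refl = ≈V-refl

  ≈V-sym : ∀ {v w} → v ≈V w → w ≈V v
  ≈V-sym (h &V k) = ≋-sym h &V ≋-sym k

  ≈V-trans : ∀ {u v w} → u ≈V v → v ≈V w → u ≈V w
  ≈V-trans (h &V k) (h′ &V k′) = ≋-trans h h′ &V ≋-trans k k′

  ≈V-setoid : Setoid 0ℓ 0ℓ
  ≈V-setoid = record
    { Carrier = V2 ; _≈_ = _≈V_ ; isEquivalence = record { refl = ≈V-refl ; sym = ≈V-sym ; trans = ≈V-trans } }

  ≈M-refl : ∀ {A} → A ≈M A
  ≈M-refl = ≈V-refl &M ≈V-refl

  ≈M-reflexive : ∀ {A B} → A ≡ B → A ≈M B
  ≈M-reflexive refl = ≈M-refl

  ≈M-sym : ∀ {A B} → A ≈M B → B ≈M A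
  ≈M-sym (h &M k) = ≈V-sym h &M ≈V-sym k

  ≈M-trans : ∀ {A B C} → A ≈M B → B ≈M C → A ≈M C
  ≈M-trans (h &M k) (h′ &M k′) = ≈V-trans h h′ &M ≈V-trans k k′

  ≈M-setoid : Setoid 0ℓ 0ℓ
  ≈M-setoid = record
    { Carrier = M2 ; _≈_ = _≈M_ ; isEquivalence = record { refl = ≈M-refl ; sym = ≈M-sym ; trans = ≈M-trans } }

  module ≈V-Reasoning = SetoidReasoning ≈V-setoid
  module ≈M-Reasoning = SetoidReasoning ≈M-setoid

  ≈V⇒≈V[p] : ∀ {v w} → v ≈V w → v ≈V[ p ] w
  ≈V⇒≈V[p] (h &V k) = ≋⇒ModEq h , ≋⇒ModEq k

  ≈V[p]⇒≈V : ∀ {v w} → v ≈V[ p ] w → v ≈V w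
  ≈V[p]⇒≈V (h , k) = ModEq⇒≋ h &V ModEq⇒≋ k

  ≈M⇒≈M[p] : ∀ {A B} → A ≈M B → A ≈M[ p ] B
  ≈M⇒≈M[p] (h &M k) = ≈V⇒≈V[p] h , ≈V⇒≈V[p] k

  ≈M[p]⇒≈M : ∀ {A B} → A ≈M[ p ] B → A ≈M B
  ≈M[p]⇒≈M (h , k) = ≈V[p]⇒≈V h &M ≈V[p]⇒≈V k

  private
    row·columns : ∀ x₁ x₂ y₁₁ y₁₂ y₂₁ y₂₂ c₁ c₂ →
      (x₁ * y₁₁ + x₂ * y₂₁) * c₁ + (x₁ * y₁₂ + x₂ * y₂₂) * c₂
      ≡ x₁ * (y₁₁ * c₁ + y₁₂ * c₂) + x₂ * (y₂₁ * c₁ + y₂₂ * c₂)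
    row·columns = solve-∀

  mulM-assoc : ∀ A B C → mulM (mulM A B) C ≡ mulM A (mulM B C)
  mulM-assoc ((a₁₁ , a₁₂) , (a₂₁ , a₂₂)) ((b₁₁ , b₁₂) , (b₂₁ , b₂₂)) ((c₁₁ , c₁₂) , (c₂₁ , c₂₂)) =
    cong₂ _,_ (cong₂ _,_ (row·columns a₁₁ a₁₂ b₁₁ b₁₂ b₂₁ b₂₂ c₁₁ c₂₁) (row·columns a₁₁ a₁₂ b₁₁ b₁₂ b₂₁ b₂₂ c₁₂ c₂₂))
              (cong₂ _,_ (row·columns a₂₁ a₂₂ b₁₁ b₁₂ b₂₁ b₂₂ c₁₁ c₂₁) (row·columns a₂₁ a₂₂ b₁₁ b₁₂ b₂₁ b₂₂ c₁₂ c₂₂))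

  apply-mulM : ∀ A B v → apply (mulM A B) v ≡ apply A (apply B v)
  apply-mulM ((a₁₁ , a₁₂) , (a₂₁ , a₂₂)) ((b₁₁ , b₁₂) , (b₂₁ , b₂₂)) (x , y) =
    cong₂ _,_ (row·columns a₁₁ a₁₂ b₁₁ b₁₂ b₂₁ b₂₂ x y) (row·columns a₂₁ a₂₂ b₁₁ b₁₂ b₂₁ b₂₂ x y)

  private
    first : ∀ u v → + 1 * u + + 0 * v ≡ u
    first = solve-∀
    second : ∀ u v → + 0 * u + + 1 * v ≡ v
    second = solve-∀

  apply-idM : ∀ v → apply idM v ≡ v
  apply-idM (x , y) = cong₂ _,_ (first x y) (second x y)

  mulM-identityˡ : ∀ A → mulM idM A ≡ A
  mulM-identityˡ ((a₁₁ , a₁₂) , (a₂₁ , a₂₂)) =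
    cong₂ _,_ (cong₂ _,_ (first a₁₁ a₂₁) (first a₁₂ a₂₂)) (cong₂ _,_ (second a₁₁ a₂₁) (second a₁₂ a₂₂))

  mulM-identityʳ : ∀ A → mulM A idM ≡ A
  mulM-identityʳ ((a₁₁ , a₁₂) , (a₂₁ , a₂₂)) =
    cong₂ _,_ (cong₂ _,_ (first′ a₁₁ a₁₂) (second′ a₁₁ a₁₂)) (cong₂ _,_ (first′ a₂₁ a₂₂) (second′ a₂₁ a₂₂))
    where
    first′ : ∀ u v → u * + 1 + v * + 0 ≡ u
    first′ = solve-∀
    second′ : ∀ u v → u * + 0 + v * + 1 ≡ v
    second′ = solve-∀

  mulM-cong : ∀ {A A′ B B′} → A ≈M A′ → B ≈M B′ → mulM A B ≈M mulM A′ B′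
  mulM-cong ((h₁₁ &V h₁₂) &M (h₂₁ &V h₂₂)) ((k₁₁ &V k₁₂) &M (k₂₁ &V k₂₂)) =
    (+-cong (*-cong h₁₁ k₁₁) (*-cong h₁₂ k₂₁) &V +-cong (*-cong h₁₁ k₁₂) (*-cong h₁₂ k₂₂)) &M
    (+-cong (*-cong h₂₁ k₁₁) (*-cong h₂₂ k₂₁) &V +-cong (*-cong h₂₁ k₁₂) (*-cong h₂₂ k₂₂))

  apply-cong : ∀ {A A′ v v′} → A ≈M A′ → v ≈V v′ → apply A v ≈V apply A′ v′
  apply-cong ((h₁₁ &V h₁₂) &M (h₂₁ &V h₂₂)) (k₁ &V k₂) =
    +-cong (*-cong h₁₁ k₁) (*-cong h₁₂ k₂) &V +-cong (*-cong h₂₁ k₁) (*-cong h₂₂ k₂)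

  mulM-congˡ : ∀ A {B B′} → B ≈M B′ → mulM A B ≈M mulM A B′
  mulM-congˡ A = mulM-cong (≈M-refl {A})

  mulM-congʳ : ∀ B {A A′} → A ≈M A′ → mulM A B ≈M mulM A′ B
  mulM-congʳ B h = mulM-cong h (≈M-refl {B})

  apply-congˡ : ∀ A {v v′} → v ≈V v′ → apply A v ≈V apply A v′
  apply-congˡ A = apply-cong (≈M-refl {A})

  apply-congʳ : ∀ v {A A′} → A ≈M A′ → apply A v ≈V apply A′ v
  apply-congʳ v h = apply-cong h (≈V-refl {v})

  powM-cong : ∀ n {A B} → A ≈M B → powM A n ≈M powM B n
  powM-cong zero    h = ≈M-refl
  powM-cong (suc n) h = mulM-cong h (powM-cong n h)

  powM-+ : ∀ A m n → powM A (m ℕ.+ n) ≈M mulM (powM A m) (powM A n)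
  powM-+ A zero    n = ≈M-reflexive (≡.sym (mulM-identityˡ (powM A n)))
  powM-+ A (suc m) n = ≈M-trans (mulM-congˡ A (powM-+ A m n))
                                (≈M-reflexive (≡.sym (mulM-assoc A (powM A m) (powM A n))))

  powM-idM : ∀ n → powM idM n ≈M idM
  powM-idM zero    = ≈M-refl
  powM-idM (suc n) = ≈M-trans (mulM-congˡ idM (powM-idM n)) (≈M-reflexive (mulM-identityˡ idM))

  powM-* : ∀ A m n → powM (powM A m) n ≈M powM A (m ℕ.* n)
  powM-* A m zero    = ≈M-reflexive (cong (powM A) (≡.sym (ℕₚ.*-zeroʳ m)))
  powM-* A m (suc n) = begin
    mulM (powM A m) (powM (powM A m) n) ≈⟨ mulM-congˡ (powM A m) (powM-* A m n) ⟩
    mulM (powM A m) (powM A (m ℕ.* n))  ≈⟨ powM-+ A m (m ℕ.* n) ⟨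
    powM A (m ℕ.+ m ℕ.* n)              ≡⟨ cong (powM A) (ℕₚ.*-suc m n) ⟨
    powM A (m ℕ.* suc n)                ∎
    where open ≈M-Reasoning

  apply-scaleV : ∀ A c v → apply A (scaleV c v) ≡ scaleV c (apply A v)
  apply-scaleV ((a₁₁ , a₁₂) , (a₂₁ , a₂₂)) c (x , y) = cong₂ _,_ (pull a₁₁ a₁₂ c x y) (pull a₂₁ a₂₂ c x y)
    where
    pull : ∀ m₁ m₂ c x y → m₁ * (c * x) + m₂ * (c * y) ≡ c * (m₁ * x + m₂ * y)
    pull = solve-∀

  scaleV-scaleV : ∀ c d v → scaleV c (scaleV d v) ≡ scaleV (c * d) v
  scaleV-scaleV c d (x , y) = cong₂ _,_ (≡.sym (ℤₚ.*-assoc c d x)) (≡.sym (ℤₚ.*-assoc c d y))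

  scaleV-1 : ∀ v → scaleV 1ℤ v ≡ v
  scaleV-1 (x , y) = cong₂ _,_ (ℤₚ.*-identityˡ x) (ℤₚ.*-identityˡ y)

  scaleV-cong : ∀ {c c′ v v′} → c ≋ c′ → v ≈V v′ → scaleV c v ≈V scaleV c′ v′
  scaleV-cong h (k₁ &V k₂) = *-cong h k₁ &V *-cong h k₂

  addV-cong : ∀ {u u′ v v′} → u ≈V u′ → v ≈V v′ → addV u v ≈V addV u′ v′
  addV-cong (h₁ &V h₂) (k₁ &V k₂) = +-cong h₁ k₁ &V +-cong h₂ k₂

  scaleV≈⇒≋1 : ∀ {c w} → ¬ (w ≈V zeroV) → scaleV c w ≈V w → c ≋ 1ℤ
  scaleV≈⇒≋1 {c} {w₁ , w₂} w≉0 (h₁ &V h₂) = mk≋ (cases (p∣? w₁))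
    where
    cancel : ∀ {x} → c * x ≋ x → ¬ p∣ x → p∣ (c - 1ℤ)
    cancel {x} cx≋x p∤x =
      [ id , (λ q → ⊥-elim (p∤x q)) ]′ (euclid (subst p∣_ (factor c x) (get≋ cx≋x)))
      where
      factor : ∀ c x → c * x - x ≡ (c - 1ℤ) * x
      factor = solve-∀
    cases : Dec (p∣ w₁) → p∣ (c - 1ℤ)
    cases (no p∤w₁)  = cancel h₁ p∤w₁
    cases (yes p∣w₁) = cancel h₂ (λ p∣w₂ → w≉0 (p∣⇒≋0 p∣w₁ &V p∣⇒≋0 p∣w₂))

  scalarM : ℤ → M2
  scalarM c = ((c , 0ℤ) , (0ℤ , c))

  scalarM-mulM : ∀ c d → mulM (scalarM c) (scalarM d) ≡ scalarM (c * d)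
  scalarM-mulM c d = cong₂ _,_ (cong₂ _,_ (diagonal₁ c d) (off c d)) (cong₂ _,_ (off′ c d) (diagonal₂ c d))
    where
    diagonal₁ : ∀ c d → c * d + 0ℤ * 0ℤ ≡ c * d
    diagonal₁ = solve-∀
    diagonal₂ : ∀ c d → 0ℤ * 0ℤ + c * d ≡ c * d
    diagonal₂ = solve-∀
    off : ∀ c d → c * 0ℤ + 0ℤ * d ≡ 0ℤ
    off = solve-∀
    off′ : ∀ c d → 0ℤ * d + c * 0ℤ ≡ 0ℤ
    off′ = solve-∀

  powM-scalarM : ∀ c n → powM (scalarM c) n ≡ scalarM (c ℤ.^ n)
  powM-scalarM c zero    = refl
  powM-scalarM c (suc n) = ≡.trans (cong (mulM (scalarM c)) (powM-scalarM c n)) (scalarM-mulM c (c ℤ.^ n))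

  scalarM-comm : ∀ c A → mulM (scalarM c) A ≡ mulM A (scalarM c)
  scalarM-comm c ((a₁₁ , a₁₂) , (a₂₁ , a₂₂)) =
    cong₂ _,_ (cong₂ _,_ (e₁₁ c a₁₁ a₂₁ a₁₂) (e₁₂ c a₁₂ a₂₂ a₁₁)) (cong₂ _,_ (e₂₁ c a₁₁ a₂₁ a₂₂) (e₂₂ c a₁₂ a₂₂ a₂₁))
    where
    e₁₁ : ∀ c x y z → c * x + 0ℤ * y ≡ x * c + z * 0ℤ
    e₁₁ = solve-∀
    e₁₂ : ∀ c x y z → c * x + 0ℤ * y ≡ z * 0ℤ + x * c
    e₁₂ = solve-∀
    e₂₁ : ∀ c x y z → 0ℤ * x + c * y ≡ y * c + z * 0ℤ
    e₂₁ = solve-∀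
    e₂₂ : ∀ c x y z → 0ℤ * x + c * y ≡ z * 0ℤ + y * c
    e₂₂ = solve-∀

  scalarM-cong : ∀ {c d} → c ≋ d → scalarM c ≈M scalarM d
  scalarM-cong h = (h &V ≋-refl) &M (≋-refl &V h)

  det : M2 → ℤ
  det ((a₁₁ , a₁₂) , (a₂₁ , a₂₂)) = a₁₁ * a₂₂ - a₁₂ * a₂₁

  tr : M2 → ℤ
  tr ((a₁₁ , a₁₂) , (a₂₁ , a₂₂)) = a₁₁ + a₂₂

  det-mulM : ∀ A B → det (mulM A B) ≡ det A * det B
  det-mulM ((a₁₁ , a₁₂) , (a₂₁ , a₂₂)) ((b₁₁ , b₁₂) , (b₂₁ , b₂₂)) = multiplicative a₁₁ a₁₂ a₂₁ a₂₂ b₁₁ b₁₂ b₂₁ b₂₂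
    where
    multiplicative : ∀ a₁₁ a₁₂ a₂₁ a₂₂ b₁₁ b₁₂ b₂₁ b₂₂ →
      (a₁₁ * b₁₁ + a₁₂ * b₂₁) * (a₂₁ * b₁₂ + a₂₂ * b₂₂) - (a₁₁ * b₁₂ + a₁₂ * b₂₂) * (a₂₁ * b₁₁ + a₂₂ * b₂₁)
      ≡ (a₁₁ * a₂₂ - a₁₂ * a₂₁) * (b₁₁ * b₂₂ - b₁₂ * b₂₁)
    multiplicative = solve-∀

  tr-mulM-comm : ∀ A B → tr (mulM A B) ≡ tr (mulM B A)
  tr-mulM-comm ((a₁₁ , a₁₂) , (a₂₁ , a₂₂)) ((b₁₁ , b₁₂) , (b₂₁ , b₂₂)) = symmetric a₁₁ a₁₂ a₂₁ a₂₂ b₁₁ b₁₂ b₂₁ b₂₂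
    where
    symmetric : ∀ a₁₁ a₁₂ a₂₁ a₂₂ b₁₁ b₁₂ b₂₁ b₂₂ →
      (a₁₁ * b₁₁ + a₁₂ * b₂₁) + (a₂₁ * b₁₂ + a₂₂ * b₂₂) ≡ (b₁₁ * a₁₁ + b₁₂ * a₂₁) + (b₂₁ * a₁₂ + b₂₂ * a₂₂)
    symmetric = solve-∀

  det-cong : ∀ {A B} → A ≈M B → det A ≋ det B
  det-cong ((h₁₁ &V h₁₂) &M (h₂₁ &V h₂₂)) = sub-cong (*-cong h₁₁ h₂₂) (*-cong h₁₂ h₂₁)

  tr-cong : ∀ {A B} → A ≈M B → tr A ≋ tr B
  tr-cong ((h₁₁ &V h₁₂) &M (h₂₁ &V h₂₂)) = +-cong h₁₁ h₂₂

  det-powM : ∀ A n → det (powM A n) ≋ det A ℤ.^ n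
  det-powM A zero    = ≋-refl
  det-powM A (suc n) = ≋-trans (≋-reflexive (det-mulM A (powM A n))) (*-cong (≋-refl {det A}) (det-powM A n))

  intertwined⇒conjugate : ∀ A B P Q → mulM P Q ≈M idM → mulM P A ≈M mulM B P → B ≈M mulM (mulM P A) Q
  intertwined⇒conjugate A B P Q PQ≈I PA≈BP = begin
    B                      ≡⟨ mulM-identityʳ B ⟨
    mulM B idM             ≈⟨ mulM-congˡ B PQ≈I ⟨
    mulM B (mulM P Q)      ≡⟨ mulM-assoc B P Q ⟨
    mulM (mulM B P) Q      ≈⟨ mulM-congʳ Q PA≈BP ⟨
    mulM (mulM P A) Q      ∎
    where open ≈M-Reasoning

  intertwined⇒tr≋ : ∀ A B P Q → mulM P Q ≈M idM → mulM Q P ≈M idM → mulM P A ≈M mulM B P → tr B ≋ tr A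
  intertwined⇒tr≋ A B P Q PQ≈I QP≈I PA≈BP = begin
    tr B                      ≈⟨ tr-cong (intertwined⇒conjugate A B P Q PQ≈I PA≈BP) ⟩
    tr (mulM (mulM P A) Q)    ≡⟨ tr-mulM-comm (mulM P A) Q ⟩
    tr (mulM Q (mulM P A))    ≡⟨ cong tr (mulM-assoc Q P A) ⟨
    tr (mulM (mulM Q P) A)    ≈⟨ tr-cong (mulM-congʳ A QP≈I) ⟩
    tr (mulM idM A)           ≡⟨ cong tr (mulM-identityˡ A) ⟩
    tr A                      ∎
    where open ≋-Reasoning

  adjugate : M2 → M2
  adjugate ((a₁₁ , a₁₂) , (a₂₁ , a₂₂)) = ((a₂₂ , - a₁₂) , (- a₂₁ , a₁₁))

  adjugate-mulM : ∀ A → mulM (adjugate A) A ≡ scalarM (det A)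
  adjugate-mulM ((a₁₁ , a₁₂) , (a₂₁ , a₂₂)) =
    cong₂ _,_ (cong₂ _,_ (d₁ a₁₁ a₁₂ a₂₁ a₂₂) (o₁ a₁₁ a₁₂ a₂₁ a₂₂))
              (cong₂ _,_ (o₂ a₁₁ a₁₂ a₂₁ a₂₂) (d₂ a₁₁ a₁₂ a₂₁ a₂₂))
    where
    d₁ : ∀ a₁₁ a₁₂ a₂₁ a₂₂ → a₂₂ * a₁₁ + - a₁₂ * a₂₁ ≡ a₁₁ * a₂₂ - a₁₂ * a₂₁
    d₁ = solve-∀
    o₁ : ∀ a₁₁ a₁₂ a₂₁ a₂₂ → a₂₂ * a₁₂ + - a₁₂ * a₂₂ ≡ 0ℤ
    o₁ = solve-∀
    o₂ : ∀ a₁₁ a₁₂ a₂₁ a₂₂ → - a₂₁ * a₁₁ + a₁₁ * a₂₁ ≡ 0ℤ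
    o₂ = solve-∀
    d₂ : ∀ a₁₁ a₁₂ a₂₁ a₂₂ → - a₂₁ * a₁₂ + a₁₁ * a₂₂ ≡ a₁₁ * a₂₂ - a₁₂ * a₂₁
    d₂ = solve-∀

  mulM-adjugate : ∀ A → mulM A (adjugate A) ≡ scalarM (det A)
  mulM-adjugate ((a₁₁ , a₁₂) , (a₂₁ , a₂₂)) =
    cong₂ _,_ (cong₂ _,_ (d₁ a₁₁ a₁₂ a₂₁ a₂₂) (o₁ a₁₁ a₁₂ a₂₁ a₂₂))
              (cong₂ _,_ (o₂ a₁₁ a₁₂ a₂₁ a₂₂) (d₂ a₁₁ a₁₂ a₂₁ a₂₂))
    where
    d₁ : ∀ a₁₁ a₁₂ a₂₁ a₂₂ → a₁₁ * a₂₂ + a₁₂ * - a₂₁ ≡ a₁₁ * a₂₂ - a₁₂ * a₂₁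
    d₁ = solve-∀
    o₁ : ∀ a₁₁ a₁₂ a₂₁ a₂₂ → a₁₁ * - a₁₂ + a₁₂ * a₁₁ ≡ 0ℤ
    o₁ = solve-∀
    o₂ : ∀ a₁₁ a₁₂ a₂₁ a₂₂ → a₂₁ * a₂₂ + a₂₂ * - a₂₁ ≡ 0ℤ
    o₂ = solve-∀
    d₂ : ∀ a₁₁ a₁₂ a₂₁ a₂₂ → a₂₁ * - a₁₂ + a₂₂ * a₁₁ ≡ a₁₁ * a₂₂ - a₁₂ * a₂₁
    d₂ = solve-∀

  Invertible : M2 → Set
  Invertible S = Σ M2 λ P → mulM P S ≈M idM × mulM S P ≈M idM

  det≉0⇒invertible : ∀ S → ¬ p∣ det S → Invertible S
  det≉0⇒invertible S p∤det = P , P·S≈I , S·P≈I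
    where
    δ = proj₁ (inverse (det S) p∤det)
    det·δ≋1 = proj₂ (inverse (det S) p∤det)
    P = mulM (scalarM δ) (adjugate S)
    P·S≈I : mulM P S ≈M idM
    P·S≈I = begin
      mulM (mulM (scalarM δ) (adjugate S)) S
        ≡⟨ mulM-assoc (scalarM δ) (adjugate S) S ⟩
      mulM (scalarM δ) (mulM (adjugate S) S)
        ≡⟨ cong (mulM (scalarM δ)) (adjugate-mulM S) ⟩
      mulM (scalarM δ) (scalarM (det S))
        ≡⟨ scalarM-mulM δ (det S) ⟩
      scalarM (δ * det S)
        ≈⟨ scalarM-cong (≋-trans (≋-reflexive (ℤₚ.*-comm δ (det S))) det·δ≋1) ⟩
      idM                                    ∎
      where open ≈M-Reasoning
    S·P≈I : mulM S P ≈M idM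
    S·P≈I = begin
      mulM S (mulM (scalarM δ) (adjugate S)) ≡⟨ cong (mulM S) (scalarM-comm δ (adjugate S)) ⟩
      mulM S (mulM (adjugate S) (scalarM δ)) ≡⟨ mulM-assoc S (adjugate S) (scalarM δ) ⟨
      mulM (mulM S (adjugate S)) (scalarM δ) ≡⟨ cong (λ M → mulM M (scalarM δ)) (mulM-adjugate S) ⟩
      mulM (scalarM (det S)) (scalarM δ)     ≡⟨ scalarM-mulM (det S) δ ⟩
      scalarM (det S * δ)                    ≈⟨ scalarM-cong det·δ≋1 ⟩
      idM                                    ∎
      where
      open ≈M-Reasoning

  columns : V2 → V2 → M2
  columns (v₁ , v₂) (w₁ , w₂) = ((v₁ , w₁) , (v₂ , w₂))

  apply-columns : ∀ v w c d → apply (columns v w) (c , d) ≡ addV (scaleV c v) (scaleV d w)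
  apply-columns (v₁ , v₂) (w₁ , w₂) c d = cong₂ _,_ (swap v₁ w₁ c d) (swap v₂ w₂ c d)
    where
    swap : ∀ v w c d → v * c + w * d ≡ c * v + d * w
    swap = solve-∀

  apply-zeroV : ∀ A → apply A zeroV ≡ zeroV
  apply-zeroV ((a₁₁ , a₁₂) , (a₂₁ , a₂₂)) = cong₂ _,_ (vanish a₁₁ a₁₂) (vanish a₂₁ a₂₂)
    where
    vanish : ∀ x y → x * 0ℤ + y * 0ℤ ≡ 0ℤ
    vanish = solve-∀

  invertible⇒Spans : ∀ v w → Invertible (columns v w) → Spans p v w
  invertible⇒Spans v w (P , _ , S·P≈I) x = c , d , ≈V⇒≈V[p] (begin
    x                                   ≡⟨ apply-idM x ⟨
    apply idM x                         ≈⟨ apply-congʳ x S·P≈I ⟨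
    apply (mulM (columns v w) P) x      ≡⟨ apply-mulM (columns v w) P x ⟩
    apply (columns v w) (c , d)         ≡⟨ apply-columns v w c d ⟩
    addV (scaleV c v) (scaleV d w)      ∎)
    where
    open ≈V-Reasoning
    c = proj₁ (apply P x)
    d = proj₂ (apply P x)

  invertible⇒independent : ∀ v w c d → Invertible (columns v w) →
                           addV (scaleV c v) (scaleV d w) ≈V zeroV → c ≋ 0ℤ × d ≋ 0ℤ
  invertible⇒independent v w c d (P , P·S≈I , _) cv+dw≈0 = ≈V₁ cd≈0 , ≈V₂ cd≈0
    where
    open ≈V-Reasoning
    cd≈0 : (c , d) ≈V zeroV
    cd≈0 = begin
      (c , d)                                     ≡⟨ apply-idM (c , d) ⟨
      apply idM (c , d)                           ≈⟨ apply-congʳ (c , d) P·S≈I ⟨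
      apply (mulM P (columns v w)) (c , d)        ≡⟨ apply-mulM P (columns v w) (c , d) ⟩
      apply P (apply (columns v w) (c , d))       ≡⟨ cong (apply P) (apply-columns v w c d) ⟩
      apply P (addV (scaleV c v) (scaleV d w))    ≈⟨ apply-congˡ P cv+dw≈0 ⟩
      apply P zeroV                               ≡⟨ apply-zeroV P ⟩
      zeroV                                       ∎

  invertible-intertwines : ∀ A C S → ((P , _) : Invertible S) → mulM A S ≈M mulM S C → mulM P A ≈M mulM C P
  invertible-intertwines A C S (P , P·S≈I , S·P≈I) AS≈SC = begin
    mulM P A
      ≡⟨ mulM-identityʳ (mulM P A) ⟨
    mulM (mulM P A) idM
      ≈⟨ mulM-congˡ (mulM P A) S·P≈I ⟨
    mulM (mulM P A) (mulM S P)
      ≡⟨ ≡.trans (mulM-assoc P A (mulM S P)) (cong (mulM P) (≡.sym (mulM-assoc A S P))) ⟩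
    mulM P (mulM (mulM A S) P)
      ≈⟨ mulM-congˡ P (mulM-congʳ P AS≈SC) ⟩
    mulM P (mulM (mulM S C) P)
      ≡⟨ ≡.trans (cong (mulM P) (mulM-assoc S C P)) (≡.sym (mulM-assoc P S (mulM C P))) ⟩
    mulM (mulM P S) (mulM C P)
      ≈⟨ mulM-congʳ (mulM C P) P·S≈I ⟩
    mulM idM (mulM C P)
      ≡⟨ mulM-identityˡ (mulM C P) ⟩
    mulM C P                          ∎
    where open ≈M-Reasoning

  intertwines-powM : ∀ A C P → mulM P A ≈M mulM C P → ∀ g → mulM P (powM A g) ≈M mulM (powM C g) P
  intertwines-powM A C P PA≈CP zero = ≈M-reflexive (≡.trans (mulM-identityʳ P) (≡.sym (mulM-identityˡ P)))
  intertwines-powM A C P PA≈CP (suc g) = begin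
    mulM P (mulM A (powM A g))    ≡⟨ mulM-assoc P A (powM A g) ⟨
    mulM (mulM P A) (powM A g)    ≈⟨ mulM-congʳ (powM A g) PA≈CP ⟩
    mulM (mulM C P) (powM A g)    ≡⟨ mulM-assoc C P (powM A g) ⟩
    mulM C (mulM P (powM A g))    ≈⟨ mulM-congˡ C (intertwines-powM A C P PA≈CP g) ⟩
    mulM C (mulM (powM C g) P)    ≡⟨ mulM-assoc C (powM C g) P ⟨
    mulM (mulM C (powM C g)) P    ∎
    where open ≈M-Reasoning

  eigenvector-powM : ∀ B w d → apply B w ≈V scaleV d w → ∀ n → apply (powM B n) w ≈V scaleV (d ℤ.^ n) w
  eigenvector-powM B w d Bw≈dw zero = ≈V-reflexive (≡.trans (apply-idM w) (≡.sym (scaleV-1 w)))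
  eigenvector-powM B w d Bw≈dw (suc n) = begin
    apply (mulM B (powM B n)) w        ≡⟨ apply-mulM B (powM B n) w ⟩
    apply B (apply (powM B n) w)       ≈⟨ apply-congˡ B (eigenvector-powM B w d Bw≈dw n) ⟩
    apply B (scaleV (d ℤ.^ n) w)       ≡⟨ apply-scaleV B (d ℤ.^ n) w ⟩
    scaleV (d ℤ.^ n) (apply B w)       ≈⟨ scaleV-cong (≋-refl {d ℤ.^ n}) Bw≈dw ⟩
    scaleV (d ℤ.^ n) (scaleV d w)      ≡⟨ scaleV-scaleV (d ℤ.^ n) d w ⟩
    scaleV (d ℤ.^ n * d) w             ≡⟨ cong (λ e → scaleV e w) (ℤₚ.*-comm (d ℤ.^ n) d) ⟩
    scaleV (d ℤ.^ suc n) w             ∎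
    where open ≈V-Reasoning

  cyclic-vector : ∀ A → (∀ c → ¬ (A ≈M scalarM c)) → Σ V2 (λ v → ¬ p∣ det (columns v (apply A v)))
  cyclic-vector A@((a₁₁ , a₁₂) , (a₂₁ , a₂₂)) non-scalar = try-e₁ (p∣? a₂₁)
    where
    try-e₁ : Dec (p∣ a₂₁) → Σ V2 (λ v → ¬ p∣ det (columns v (apply A v)))
    try-e₁ (no p∤a₂₁)  = (1ℤ , 0ℤ) , (λ h → p∤a₂₁ (subst p∣_ (det-e₁ a₁₁ a₁₂ a₂₁ a₂₂) h))
      where
      det-e₁ : ∀ a₁₁ a₁₂ a₂₁ a₂₂ → + 1 * (a₂₁ * + 1 + a₂₂ * + 0) - (a₁₁ * + 1 + a₁₂ * + 0) * + 0 ≡ a₂₁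
      det-e₁ = solve-∀
    try-e₁ (yes p∣a₂₁) = try-e₂ (p∣? a₁₂)
      where
      try-e₂ : Dec (p∣ a₁₂) → Σ V2 (λ v → ¬ p∣ det (columns v (apply A v)))
      try-e₂ (no p∤a₁₂)  = (0ℤ , 1ℤ) , (λ h → p∤a₁₂ (subst p∣_ (det-e₂ a₁₁ a₁₂ a₂₁ a₂₂) (ℤ∣.∣m⇒∣-m h)))
        where
        det-e₂ : ∀ a₁₁ a₁₂ a₂₁ a₂₂ → - (+ 0 * (a₂₁ * + 0 + a₂₂ * + 1) - (a₁₁ * + 0 + a₁₂ * + 1) * + 1) ≡ a₁₂
        det-e₂ = solve-∀
      try-e₂ (yes p∣a₁₂) = try-e₁+e₂ (p∣? (a₂₂ - a₁₁))
        where
        try-e₁+e₂ : Dec (p∣ (a₂₂ - a₁₁)) → Σ V2 (λ v → ¬ p∣ det (columns v (apply A v)))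
        try-e₁+e₂ (no p∤a₂₂-a₁₁) = (1ℤ , 1ℤ) , λ h →
          p∤a₂₂-a₁₁ (ℤ∣.∣m+n∣n⇒∣m (subst p∣_ (det-e₁+e₂ a₁₁ a₁₂ a₂₁ a₂₂) h) (ℤ∣.∣m∣n⇒∣m-n p∣a₂₁ p∣a₁₂))
          where
          det-e₁+e₂ : ∀ a₁₁ a₁₂ a₂₁ a₂₂ →
            + 1 * (a₂₁ * + 1 + a₂₂ * + 1) - (a₁₁ * + 1 + a₁₂ * + 1) * + 1 ≡ (a₂₂ - a₁₁) + (a₂₁ - a₁₂)
          det-e₁+e₂ = solve-∀
        try-e₁+e₂ (yes p∣a₂₂-a₁₁) =
          ⊥-elim (non-scalar a₁₁ ((≋-refl {a₁₁} &V p∣⇒≋0 p∣a₁₂) &M (p∣⇒≋0 p∣a₂₁ &V mk≋ p∣a₂₂-a₁₁)))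

  companion-basis : ∀ A v t → apply A (apply A v) ≈V addV (scaleV (- 1ℤ) v) (scaleV t (apply A v)) →
                    mulM A (columns v (apply A v)) ≈M mulM (columns v (apply A v)) ((+ 0 , - (+ 1)) , (+ 1 , t))
  companion-basis A v t (h₁ &V h₂) =
    (≋-reflexive (≡.sym (first-column w₁ v₁)) &V ≋-trans h₁ (≋-reflexive (second-column v₁ w₁ t))) &M
    (≋-reflexive (≡.sym (first-column w₂ v₂)) &V ≋-trans h₂ (≋-reflexive (second-column v₂ w₂ t)))
    where
    v₁ = proj₁ v
    v₂ = proj₂ v
    w₁ = proj₁ (apply A v)
    w₂ = proj₂ (apply A v)
    first-column : ∀ w v → v * + 0 + w * + 1 ≡ w
    first-column = solve-∀
    second-column : ∀ v w t → (- 1ℤ) * v + t * w ≡ v * - (+ 1) + w * t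
    second-column = solve-∀

  polyM : ℤ → ℤ → M2 → M2
  polyM x y ((a₁₁ , a₁₂) , (a₂₁ , a₂₂)) = ((x + y * a₁₁ , y * a₁₂) , (y * a₂₁ , x + y * a₂₂))

  apply-polyM : ∀ x y A v → apply (polyM x y A) v ≡ addV (scaleV x v) (scaleV y (apply A v))
  apply-polyM x y ((a₁₁ , a₁₂) , (a₂₁ , a₂₂)) (v₁ , v₂) =
    cong₂ _,_ (expand x y a₁₁ a₁₂ v₁ v₂) (expand′ x y a₂₁ a₂₂ v₁ v₂)
    where
    expand : ∀ x y a₁₁ a₁₂ v₁ v₂ → (x + y * a₁₁) * v₁ + (y * a₁₂) * v₂ ≡ x * v₁ + y * (a₁₁ * v₁ + a₁₂ * v₂)
    expand = solve-∀
    expand′ : ∀ x y a₂₁ a₂₂ v₁ v₂ → (y * a₂₁) * v₁ + (x + y * a₂₂) * v₂ ≡ x * v₂ + y * (a₂₁ * v₁ + a₂₂ * v₂)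
    expand′ = solve-∀

  polyM-cong : ∀ {x x′ y y′} A → x ≋ x′ → y ≋ y′ → polyM x y A ≈M polyM x′ y′ A
  polyM-cong ((a₁₁ , a₁₂) , (a₂₁ , a₂₂)) h k =
    (+-cong h (*-cong k (≋-refl {a₁₁})) &V *-cong k (≋-refl {a₁₂})) &M
    (*-cong k (≋-refl {a₂₁}) &V +-cong h (*-cong k (≋-refl {a₂₂})))

  polyM-1-0 : ∀ A → polyM 1ℤ 0ℤ A ≡ idM
  polyM-1-0 ((a₁₁ , a₁₂) , (a₂₁ , a₂₂)) = cong₂ _,_ (cong₂ _,_ (one a₁₁) (zero′ a₁₂)) (cong₂ _,_ (zero′ a₂₁) (one a₂₂))
    where
    one : ∀ u → + 1 + + 0 * u ≡ + 1
    one = solve-∀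
    zero′ : ∀ u → + 0 * u ≡ + 0
    zero′ = solve-∀

  cayley-hamilton : ∀ x y A → mulM A (polyM x y A) ≡ polyM (- (y * det A)) (x + tr A * y) A
  cayley-hamilton x y ((a₁₁ , a₁₂) , (a₂₁ , a₂₂)) =
    cong₂ _,_ (cong₂ _,_ (e₁₁ x y a₁₁ a₁₂ a₂₁ a₂₂) (e₁₂ x y a₁₁ a₁₂ a₂₁ a₂₂))
              (cong₂ _,_ (e₂₁ x y a₁₁ a₁₂ a₂₁ a₂₂) (e₂₂ x y a₁₁ a₁₂ a₂₁ a₂₂))
    where
    e₁₁ : ∀ x y a₁₁ a₁₂ a₂₁ a₂₂ →
      a₁₁ * (x + y * a₁₁) + a₁₂ * (y * a₂₁) ≡ - (y * (a₁₁ * a₂₂ - a₁₂ * a₂₁)) + (x + (a₁₁ + a₂₂) * y) * a₁₁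
    e₁₁ = solve-∀
    e₁₂ : ∀ x y a₁₁ a₁₂ a₂₁ a₂₂ → a₁₁ * (y * a₁₂) + a₁₂ * (x + y * a₂₂) ≡ (x + (a₁₁ + a₂₂) * y) * a₁₂
    e₁₂ = solve-∀
    e₂₁ : ∀ x y a₁₁ a₁₂ a₂₁ a₂₂ → a₂₁ * (x + y * a₁₁) + a₂₂ * (y * a₂₁) ≡ (x + (a₁₁ + a₂₂) * y) * a₂₁
    e₂₁ = solve-∀
    e₂₂ : ∀ x y a₁₁ a₁₂ a₂₁ a₂₂ →
      a₂₁ * (y * a₁₂) + a₂₂ * (x + y * a₂₂) ≡ - (y * (a₁₁ * a₂₂ - a₁₂ * a₂₁)) + (x + (a₁₁ + a₂₂) * y) * a₂₂
    e₂₂ = solve-∀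

  cayley-hamilton-apply : ∀ A v → apply A (apply A v) ≡ addV (scaleV (- det A) v) (scaleV (tr A) (apply A v))
  cayley-hamilton-apply ((a₁₁ , a₁₂) , (a₂₁ , a₂₂)) (v₁ , v₂) =
    cong₂ _,_ (upper a₁₁ a₁₂ a₂₁ a₂₂ v₁ v₂) (lower a₁₁ a₁₂ a₂₁ a₂₂ v₁ v₂)
    where
    upper : ∀ a₁₁ a₁₂ a₂₁ a₂₂ v₁ v₂ → a₁₁ * (a₁₁ * v₁ + a₁₂ * v₂) + a₁₂ * (a₂₁ * v₁ + a₂₂ * v₂)
      ≡ (- (a₁₁ * a₂₂ - a₁₂ * a₂₁)) * v₁ + (a₁₁ + a₂₂) * (a₁₁ * v₁ + a₁₂ * v₂)
    upper = solve-∀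
    lower : ∀ a₁₁ a₁₂ a₂₁ a₂₂ v₁ v₂ → a₂₁ * (a₁₁ * v₁ + a₁₂ * v₂) + a₂₂ * (a₂₁ * v₁ + a₂₂ * v₂)
      ≡ (- (a₁₁ * a₂₂ - a₁₂ * a₂₁)) * v₂ + (a₁₁ + a₂₂) * (a₂₁ * v₁ + a₂₂ * v₂)
    lower = solve-∀

  powM≈polyM-α-β : ∀ A → det A ≋ 1ℤ → ∀ n → powM A n ≈M polyM (α (tr A) n) (β (tr A) n) A
  powM≈polyM-α-β A det≋1 zero = ≈M-sym (≈M-reflexive (polyM-1-0 A))
  powM≈polyM-α-β A det≋1 (suc n) = begin
    mulM A (powM A n)
      ≈⟨ mulM-congˡ A (powM≈polyM-α-β A det≋1 n) ⟩
    mulM A (polyM (α t n) (β t n) A)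
      ≡⟨ cayley-hamilton (α t n) (β t n) A ⟩
    polyM (- (β t n * det A)) (α t n + t * β t n) A
      ≈⟨ polyM-cong A (neg-cong (≋-trans (*-cong (≋-refl {β t n}) det≋1) (≋-reflexive (ℤₚ.*-identityʳ (β t n)))))
                      (≋-refl {α t n + t * β t n}) ⟩
    polyM (α t (suc n)) (β t (suc n)) A                              ∎
    where
    open ≈M-Reasoning
    t = tr A

  powM≈idM : ∀ A → det A ≋ 1ℤ → ∀ n → α (tr A) n ≋ 1ℤ → β (tr A) n ≋ 0ℤ → powM A n ≈M idM
  powM≈idM A det≋1 n α≋1 β≋0 =
    ≈M-trans (powM≈polyM-α-β A det≋1 n) (≈M-trans (polyM-cong A α≋1 β≋0) (≈M-reflexive (polyM-1-0 A)))

module _ where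

  open import Data.Integer using (_+_; _*_; -_; _-_)

  ModEq-refl : ∀ ℓ j → ModEq ℓ j j
  ModEq-refl ℓ j = subst (λ x → ℓ ∣ ℤ.∣ x ∣) (≡.sym (ℤₚ.+-inverseʳ j)) (ℕ∣.divides 0 refl)

  ModEq-sym : ∀ ℓ x y → ModEq ℓ x y → ModEq ℓ y x
  ModEq-sym ℓ x y = subst (ℓ ∣_) (ℤₚ.∣i-j∣≡∣j-i∣ x y)

  ModEq⇒∣∸ : ∀ ℓ m n → m ℕ.≤ n → ModEq ℓ (+ m) (+ n) → ℓ ∣ n ℕ.∸ m
  ModEq⇒∣∸ ℓ m n m≤n = subst (ℓ ∣_) distance
    where
    distance : ℤ.∣ + m - + n ∣ ≡ n ℕ.∸ m
    distance = ≡.trans (cong ℤ.∣_∣ (ℤₚ.m-n≡m⊖n m n)) (≡.trans (ℤₚ.∣m⊖n∣≡∣n⊖m∣ m n) (cong ℤ.∣_∣ (ℤₚ.⊖-≥ m≤n)))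

module _ {p ℓ : ℕ} (ℓ∣p+1 : ℓ ∣ p ℕ.+ 1) where

  open import Data.Integer using (_+_; _*_; -_; _-_)

  private
    ℓ∣_ : ℤ → Set
    ℓ∣ x = + ℓ ℤ∣.∣ x

    ℓ∣p+1ℤ : ℓ∣ (+ p + 1ℤ)
    ℓ∣p+1ℤ = subst ℓ∣_ (ℤₚ.pos-+ p 1) (ℤ∣.∣ᵤ⇒∣ ℓ∣p+1)

  ModEq-p-swap : ∀ j₁ j₂ → ModEq ℓ (+ j₁) (+ (p ℕ.* j₂)) → ModEq ℓ (+ (p ℕ.* j₁)) (+ j₂)
  ModEq-p-swap j₁ j₂ j₁≡pj₂ = ℤ∣.∣⇒∣ᵤ (subst ℓ∣_ (≡.sym difference)
    (ℤ∣.∣m∣n⇒∣m+n (ℤ∣.∣n⇒∣m*n (+ p) (subst (λ x → ℓ∣ (+ j₁ - x)) (ℤₚ.pos-* p j₂) (ℤ∣.∣ᵤ⇒∣ j₁≡pj₂)))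
                  (ℤ∣.∣n⇒∣m*n (+ p - 1ℤ) (ℤ∣.∣m⇒∣m*n (+ j₂) ℓ∣p+1ℤ))))
    where
    difference : + (p ℕ.* j₁) - + j₂ ≡ + p * (+ j₁ - + p * + j₂) + (+ p - 1ℤ) * ((+ p + 1ℤ) * + j₂)
    difference = ≡.trans (cong (_- + j₂) (ℤₚ.pos-* p j₁)) (expand (+ p) (+ j₁) (+ j₂))
      where
      expand : ∀ p j₁ j₂ → p * j₁ - j₂ ≡ p * (j₁ - p * j₂) + (p - 1ℤ) * ((p + 1ℤ) * j₂)
      expand = solve-∀

  +≡ℓ⇒ModEq-p : ∀ j₁ j₂ → j₁ ℕ.+ j₂ ≡ ℓ → ModEq ℓ (+ j₁) (+ (p ℕ.* j₂))
  +≡ℓ⇒ModEq-p j₁ j₂ j₁+j₂≡ℓ = ℤ∣.∣⇒∣ᵤ (subst ℓ∣_ (≡.sym difference)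
    (ℤ∣.∣m∣n⇒∣m-n ℤ∣.∣-refl (ℤ∣.∣m⇒∣m*n (+ j₂) ℓ∣p+1ℤ)))
    where
    j₁≡ℓ-j₂ : + j₁ ≡ + ℓ - + j₂
    j₁≡ℓ-j₂ = ≡.sym (≡.trans (cong (λ n → + n - + j₂) (≡.sym j₁+j₂≡ℓ))
                (≡.trans (cong (_- + j₂) (ℤₚ.pos-+ j₁ j₂)) (cancel (+ j₁) (+ j₂))))
      where
      cancel : ∀ x y → (x + y) - y ≡ x
      cancel = solve-∀
    difference : + j₁ - + (p ℕ.* j₂) ≡ + ℓ - (+ p + 1ℤ) * + j₂
    difference = ≡.trans (cong₂ _-_ j₁≡ℓ-j₂ (ℤₚ.pos-* p j₂)) (regroup (+ ℓ) (+ j₂) (+ p))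
      where
      regroup : ∀ l j p → l - j - p * j ≡ l - (p + 1ℤ) * j
      regroup = solve-∀

-- gcd (p ℓ) (p + 1) is prime to p, so it divides ℓ; not being 2⁰, it is ℓ.
D₂⇒∣suc : ∀ {p ℓ} → Prime ℓ → D₂ p (p ℕ.* ℓ) → ℓ ∣ p ℕ.+ 1
D₂⇒∣suc {p} {ℓ} ℓ-prime (_ , _ , not-power-of-2) =
  [ (λ g≡1 → ⊥-elim (not-power-of-2 (0 , g≡1)))
  , (λ g≡ℓ → subst (_∣ p ℕ.+ 1) g≡ℓ (gcd[m,n]∣n (p ℕ.* ℓ) (p ℕ.+ 1)))
  ]′ (prime⇒irreducible ℓ-prime g∣ℓ)
  where
  g = gcd (p ℕ.* ℓ) (p ℕ.+ 1)
  g-coprime-p : Coprime g p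
  g-coprime-p (d∣g , d∣p) = ℕ∣.∣1⇒≡1 (ℕ∣.∣m+n∣m⇒∣n (ℕ∣.∣-trans d∣g (gcd[m,n]∣n (p ℕ.* ℓ) (p ℕ.+ 1))) d∣p)
  g∣ℓ : g ∣ ℓ
  g∣ℓ = coprime-divisor g-coprime-p (gcd[m,n]∣m (p ℕ.* ℓ) (p ℕ.+ 1))

∣suc⇒∤ : ∀ {p ℓ} → 1 ℕ.< p → ℓ ∣ p ℕ.+ 1 → ¬ p ∣ ℓ
∣suc⇒∤ {p} 1<p ℓ∣p+1 p∣ℓ =
  ℕₚ.<⇒≢ 1<p (≡.sym (ℕ∣.∣1⇒≡1 (ℕ∣.∣m+n∣m⇒∣n (ℕ∣.∣-trans p∣ℓ ℓ∣p+1) ℕ∣.∣-refl)))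

module RootsOfUnity (p : ℕ) (p-prime : Prime p) (a b : ℤ) (irreducible : Irreducible p a b)
                    (ℓ : ℕ) (ℓ-prime : Prime ℓ) (p∤ℓ : ¬ p ∣ ℓ)
                    (ζ : E) (ζ-primitive : PrimitiveRoot p a b ℓ ζ) (ζ∉𝔽ₚ′ : NotInPrimeField p ζ) where

  open import Data.Integer using (_+_; _*_; -_; _-_)

  open ModPrime p p-prime
  open QuadraticField p p-prime a b irreducible
  open Solver using (solve; _:+_; _:*_; _:-_; :-_; _:=_; con)

  private
    module R = CommutativeRing ring

  0<ℓ : 0 ℕ.< ℓ
  0<ℓ = ℕₚ.<-trans (s≤s z≤n) (prime⇒>1 ℓ-prime)

  ζ^ℓ≈1 : ζ ^ ℓ ≈ oneE
  ζ^ℓ≈1 = ≈E⇒≈ (proj₁ ζ-primitive)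

  ζ^≉1 : ∀ k → 0 ℕ.< k → k ℕ.< ℓ → ¬ (ζ ^ k ≈ oneE)
  ζ^≉1 k 0<k k<ℓ e = proj₂ ζ-primitive k 0<k k<ℓ (≈⇒≈E e)

  ζ∉𝔽ₚ : ¬ ζ ∈𝔽ₚ
  ζ∉𝔽ₚ (in𝔽ₚ h) = ζ∉𝔽ₚ′ (≋⇒ModEq (p∣⇒≋0 h))

  ζ^[ℓ*q]≈1 : ∀ q → ζ ^ (ℓ ℕ.* q) ≈ oneE
  ζ^[ℓ*q]≈1 q = ≈-trans (≈-sym (^-* ζ ℓ q)) (≈-trans (^-cong q ζ^ℓ≈1) (1^ q))

  [ζ^k]^ℓ≈1 : ∀ k → (ζ ^ k) ^ ℓ ≈ oneE
  [ζ^k]^ℓ≈1 k = ≈-trans (^-comm ζ k ℓ) (≈-trans (^-* ζ ℓ k) (ζ^[ℓ*q]≈1 k))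

  ζ^[r+ℓ*q] : ∀ r q → ζ ^ (r ℕ.+ ℓ ℕ.* q) ≈ ζ ^ r
  ζ^[r+ℓ*q] r q = ≈-trans (^-+ ζ r (ℓ ℕ.* q)) (≈-trans (·-cong (≈-refl {ζ ^ r}) (ζ^[ℓ*q]≈1 q)) (R.*-identityʳ (ζ ^ r)))

  ζ^≉0 : ∀ m → ¬ (ζ ^ m ≈ 0E)
  ζ^≉0 m ζ^m≈0 = 1≉0 (begin
    oneE            ≈⟨ [ζ^k]^ℓ≈1 m ⟨
    (ζ ^ m) ^ ℓ     ≈⟨ ^-cong ℓ ζ^m≈0 ⟩
    0E ^ ℓ          ≡⟨ cong (0E ^_) (ℕₚ.suc-pred ℓ {{ℕ.>-nonZero 0<ℓ}}) ⟨
    0E ^ suc (ℕ.pred ℓ) ≈⟨ 0^suc (ℕ.pred ℓ) ⟩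
    0E              ∎)
    where open ≈-Reasoning

  ζ^≈1⇒≡0 : ∀ d → d ℕ.< ℓ → ζ ^ d ≈ oneE → d ≡ 0
  ζ^≈1⇒≡0 zero    _   _ = refl
  ζ^≈1⇒≡0 (suc d) d<ℓ e = ⊥-elim (ζ^≉1 (suc d) (s≤s z≤n) d<ℓ e)

  ζ^-injective-≤ : ∀ m n → m ℕ.≤ n → n ℕ.< ℓ → ζ ^ m ≈ ζ ^ n → m ≡ n
  ζ^-injective-≤ m n m≤n n<ℓ e = begin
    m               ≡⟨ ℕₚ.+-identityʳ m ⟨
    m ℕ.+ 0         ≡⟨ cong (m ℕ.+_) d≡0 ⟨
    m ℕ.+ (n ℕ.∸ m) ≡⟨ ℕₚ.m+[n∸m]≡n m≤n ⟩
    n               ∎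
    where
    open ≡.≡-Reasoning
    d = n ℕ.∸ m
    ζ^m·ζ^d≈ζ^m·1 : ζ ^ m · ζ ^ d ≈ ζ ^ m · oneE
    ζ^m·ζ^d≈ζ^m·1 = ≈-trans (≈-sym (^-+ ζ m d)) (≈-trans (≈-reflexive (cong (ζ ^_) (ℕₚ.m+[n∸m]≡n m≤n)))
                      (≈-trans (≈-sym e) (≈-sym (R.*-identityʳ (ζ ^ m)))))
    d≡0 : d ≡ 0
    d≡0 = ζ^≈1⇒≡0 d (ℕₚ.≤-<-trans (ℕₚ.m∸n≤m n m) n<ℓ) (·-cancelˡ (ζ^≉0 m) ζ^m·ζ^d≈ζ^m·1)

  ζ^-injective : ∀ m n → m ℕ.< ℓ → n ℕ.< ℓ → ζ ^ m ≈ ζ ^ n → m ≡ n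
  ζ^-injective m n m<ℓ n<ℓ e with ℕₚ.≤-total m n
  ... | inj₁ m≤n = ζ^-injective-≤ m n m≤n n<ℓ e
  ... | inj₂ n≤m = ≡.sym (ζ^-injective-≤ n m n≤m m<ℓ (≈-sym e))

  -- By Bézout, ζ is a power of ζᵏ or the inverse of one.
  ζ^∉𝔽ₚ : ∀ k → 0 ℕ.< k → k ℕ.< ℓ → ¬ (ζ ^ k) ∈𝔽ₚ
  ζ^∉𝔽ₚ k@(suc _) 0<k k<ℓ ζ^k∈𝔽ₚ = cases (coprime-Bézout (prime⇒coprime ℓ-prime k<ℓ))
    where
    open ≈-Reasoning
    ζ^[y*k]∈𝔽ₚ : ∀ y → (ζ ^ (y ℕ.* k)) ∈𝔽ₚ
    ζ^[y*k]∈𝔽ₚ y = ∈𝔽ₚ-resp-≈ (≈-trans (^-* ζ k y) (≈-reflexive (cong (ζ ^_) (ℕₚ.*-comm k y)))) (^-∈𝔽ₚ y ζ^k∈𝔽ₚ)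
    cases : Bézout.Identity 1 ℓ k → ⊥
    cases (Bézout.+- x y eq) = ζ∉𝔽ₚ (·≈1⇒∈𝔽ₚ (ζ^[y*k]∈𝔽ₚ y) (begin
      ζ ^ (y ℕ.* k) · ζ       ≈⟨ R.*-comm (ζ ^ (y ℕ.* k)) ζ ⟩
      ζ ^ (1 ℕ.+ y ℕ.* k)     ≡⟨ cong (ζ ^_) (≡.trans eq (ℕₚ.*-comm x ℓ)) ⟩
      ζ ^ (ℓ ℕ.* x)           ≈⟨ ζ^[ℓ*q]≈1 x ⟩
      oneE                    ∎))
    cases (Bézout.-+ x y eq) = ζ∉𝔽ₚ (∈𝔽ₚ-resp-≈ (begin
      ζ ^ (y ℕ.* k)           ≡⟨ cong (ζ ^_) eq ⟨
      ζ ^ (1 ℕ.+ x ℕ.* ℓ)     ≡⟨ cong (λ e → ζ ^ (1 ℕ.+ e)) (ℕₚ.*-comm x ℓ) ⟩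
      ζ ^ (1 ℕ.+ ℓ ℕ.* x)     ≈⟨ ζ^[r+ℓ*q] 1 x ⟩
      ζ · oneE                ≈⟨ R.*-identityʳ ζ ⟩
      ζ                       ∎) (ζ^[y*k]∈𝔽ₚ y))

  ζ^-resp-ModEq : ∀ m n → ModEq ℓ (+ m) (+ n) → ζ ^ m ≈ ζ ^ n
  ζ^-resp-ModEq m n m≡n = [ (λ m≤n → ≈-sym (reduce m n m≤n (ModEq⇒∣∸ ℓ m n m≤n m≡n)))
                          , (λ n≤m → reduce n m n≤m (ModEq⇒∣∸ ℓ n m n≤m (ModEq-sym ℓ (+ m) (+ n) m≡n)))
                          ]′ (ℕₚ.≤-total m n)
    where
    reduce : ∀ m n → m ℕ.≤ n → ℓ ∣ n ℕ.∸ m → ζ ^ n ≈ ζ ^ m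
    reduce m n m≤n (ℕ∣.divides q n∸m≡qℓ) = ≈-trans (≈-reflexive (cong (ζ ^_) n≡m+ℓq)) (ζ^[r+ℓ*q] m q)
      where
      n≡m+ℓq : n ≡ m ℕ.+ ℓ ℕ.* q
      n≡m+ℓq = ≡.trans (≡.sym (ℕₚ.m+[n∸m]≡n m≤n)) (cong (m ℕ.+_) (≡.trans n∸m≡qℓ (ℕₚ.*-comm q ℓ)))

  ζ^[m+n]≈1⇒≡ℓ : ∀ m n → 0 ℕ.< m → m ℕ.< ℓ → n ℕ.< ℓ → ζ ^ (m ℕ.+ n) ≈ oneE → m ℕ.+ n ≡ ℓ
  ζ^[m+n]≈1⇒≡ℓ m n 0<m m<ℓ n<ℓ ζ^[m+n]≈1 = cases (ℕₚ.<-cmp (m ℕ.+ n) ℓ)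
    where
    cases : Tri (m ℕ.+ n ℕ.< ℓ) (m ℕ.+ n ≡ ℓ) (ℓ ℕ.< m ℕ.+ n) → m ℕ.+ n ≡ ℓ
    cases (tri< m+n<ℓ _ _) = ⊥-elim (ζ^≉1 (m ℕ.+ n) (ℕₚ.<-≤-trans 0<m (ℕₚ.m≤m+n m n)) m+n<ℓ ζ^[m+n]≈1)
    cases (tri≈ _ m+n≡ℓ _) = m+n≡ℓ
    cases (tri> _ _ ℓ<m+n) = begin
      m ℕ.+ n              ≡⟨ ℕₚ.m∸n+n≡m (ℕₚ.<⇒≤ ℓ<m+n) ⟨
      r ℕ.+ ℓ              ≡⟨ cong (ℕ._+ ℓ) r≡0 ⟩
      ℓ                    ∎
      where
      open ≡.≡-Reasoning
      r = m ℕ.+ n ℕ.∸ ℓ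
      r+ℓ*1≡m+n : r ℕ.+ ℓ ℕ.* 1 ≡ m ℕ.+ n
      r+ℓ*1≡m+n = ≡.trans (cong (r ℕ.+_) (ℕₚ.*-identityʳ ℓ)) (ℕₚ.m∸n+n≡m (ℕₚ.<⇒≤ ℓ<m+n))
      r<ℓ : r ℕ.< ℓ
      r<ℓ = ℕₚ.+-cancelʳ-< ℓ r ℓ (subst (ℕ._< ℓ ℕ.+ ℓ) (≡.sym (ℕₚ.m∸n+n≡m (ℕₚ.<⇒≤ ℓ<m+n))) (ℕₚ.+-mono-< m<ℓ n<ℓ))
      r≡0 : r ≡ 0
      r≡0 = ζ^≈1⇒≡0 r r<ℓ (≈-trans (≈-sym (ζ^[r+ℓ*q] r 1)) (≈-trans (≈-reflexive (cong (ζ ^_) r+ℓ*1≡m+n)) ζ^[m+n]≈1))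

  sum : ℕ → (ℕ → E) → E
  sum zero    f = 0E
  sum (suc n) f = f n ⊕ sum n f

  sum-cong : ∀ n {f g} → (∀ k → k ℕ.< n → f k ≈ g k) → sum n f ≈ sum n g
  sum-cong zero    f≈g = ≈-refl
  sum-cong (suc n) f≈g = ⊕-cong (f≈g n ℕₚ.≤-refl) (sum-cong n (λ k k<n → f≈g k (ℕₚ.m<n⇒m<1+n k<n)))

  sum-⊕ : ∀ n f g → sum n (λ k → f k ⊕ g k) ≈ sum n f ⊕ sum n g
  sum-⊕ zero    f g = ≈-sym (R.+-identityˡ 0E)
  sum-⊕ (suc n) f g = ≈-trans (⊕-cong (≈-refl {f n ⊕ g n}) (sum-⊕ n f g))
    (solve 4 (λ x y X Y → (x :+ y) :+ (X :+ Y) := (x :+ X) :+ (y :+ Y)) ≈-refl (f n) (g n) (sum n f) (sum n g))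

  sum-· : ∀ n c f → sum n (λ k → c · f k) ≈ c · sum n f
  sum-· zero    c f = ≈-sym (R.zeroʳ c)
  sum-· (suc n) c f = ≈-trans (⊕-cong (≈-refl {c · f n}) (sum-· n c f)) (≈-sym (R.distribˡ c (f n) (sum n f)))

  sum-0 : ∀ n f → (∀ k → k ℕ.< n → f k ≈ 0E) → sum n f ≈ 0E
  sum-0 n f f≈0 = ≈-trans (sum-cong n f≈0) (sum-const-0 n)
    where
    sum-const-0 : ∀ n → sum n (λ _ → 0E) ≈ 0E
    sum-const-0 zero    = ≈-refl
    sum-const-0 (suc n) = ≈-trans (R.+-identityˡ (sum n (λ _ → 0E))) (sum-const-0 n)

  sum-1 : ∀ n → sum n (λ _ → oneE) ≈ ι (+ n)
  sum-1 zero    = ≈-refl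
  sum-1 (suc n) = ≈-trans (⊕-cong (≈-refl {oneE}) (sum-1 n)) (≈-reflexive (cong ι (≡.sym (ℤₚ.pos-+ 1 n))))

  sum-geometric : ∀ w n → (w ⊕ negE oneE) · sum n (w ^_) ≈ w ^ n ⊕ negE oneE
  sum-geometric w zero    = ≈-trans (R.zeroʳ (w ⊕ negE oneE)) (≈-sym (R.-‿inverseʳ oneE))
  sum-geometric w (suc n) = begin
    (w ⊕ negE oneE) · (w ^ n ⊕ sum n (w ^_))
      ≈⟨ R.distribˡ (w ⊕ negE oneE) (w ^ n) (sum n (w ^_)) ⟩
    (w ⊕ negE oneE) · w ^ n ⊕ (w ⊕ negE oneE) · sum n (w ^_)
      ≈⟨ ⊕-cong (≈-refl {(w ⊕ negE oneE) · w ^ n}) (sum-geometric w n) ⟩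
    (w ⊕ negE oneE) · w ^ n ⊕ (w ^ n ⊕ negE oneE)
      ≈⟨ solve 2 (λ w X → (w :- con 1ℤ) :* X :+ (X :- con 1ℤ) := w :* X :- con 1ℤ) ≈-refl w (w ^ n) ⟩
    w ^ suc n ⊕ negE oneE                                   ∎
    where open ≈-Reasoning

  power-sum : ℕ → E
  power-sum s = sum ℓ (λ k → (ζ ^ k) ^ s)

  power-sum-0 : power-sum 0 ≈ ι (+ ℓ)
  power-sum-0 = sum-1 ℓ

  power-sum-vanishes : ∀ s → 0 ℕ.< s → s ℕ.< ℓ → power-sum s ≈ 0E
  power-sum-vanishes s 0<s s<ℓ =
    [ (λ ζ^s-1≈0 → ⊥-elim (ζ^≉1 s 0<s s<ℓ (≈0⇒≈ ζ^s-1≈0)))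
    , (λ Σ≈0 → ≈-trans (sum-cong ℓ (λ k _ → ^-comm ζ k s)) Σ≈0)
    ]′ (x·y≈0⇒x≈0∨y≈0 (≈-trans (sum-geometric (ζ ^ s) ℓ) (≈⇒≈0 ([ζ^k]^ℓ≈1 s))))

  constant : List E → E
  constant []      = 0E
  constant (c ∷ _) = c

  -- Σₖ ζ^{ks} P(ζᵏ): peeling off coefficients of P, only the constant term meets power-sum 0.
  shifted-sum : List E → ℕ → E
  shifted-sum cs s = sum ℓ (λ k → (ζ ^ k) ^ s · eval cs (ζ ^ k))

  shifted-sum-∷ : ∀ s c cs → shifted-sum (c ∷ cs) s ≈ c · power-sum s ⊕ shifted-sum cs (suc s)
  shifted-sum-∷ s c cs = begin
    sum ℓ (λ k → (ζ ^ k) ^ s · (c ⊕ ζ ^ k · eval cs (ζ ^ k)))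
      ≈⟨ sum-cong ℓ (λ k _ → step (ζ ^ k)) ⟩
    sum ℓ (λ k → c · (ζ ^ k) ^ s ⊕ (ζ ^ k) ^ suc s · eval cs (ζ ^ k))
      ≈⟨ sum-⊕ ℓ (λ k → c · (ζ ^ k) ^ s) (λ k → (ζ ^ k) ^ suc s · eval cs (ζ ^ k)) ⟩
    sum ℓ (λ k → c · (ζ ^ k) ^ s) ⊕ shifted-sum cs (suc s)
      ≈⟨ ⊕-cong (sum-· ℓ c (λ k → (ζ ^ k) ^ s)) (≈-refl {shifted-sum cs (suc s)}) ⟩
    c · power-sum s ⊕ shifted-sum cs (suc s) ∎
    where
    open ≈-Reasoning
    step : ∀ y → y ^ s · (c ⊕ y · eval cs y) ≈ c · y ^ s ⊕ y ^ suc s · eval cs y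
    step y = solve 4 (λ Y c y ev → Y :* (c :+ y :* ev) := c :* Y :+ (y :* Y) :* ev) ≈-refl (y ^ s) c y (eval cs y)

  shifted-sum-vanishes : ∀ cs s → 0 ℕ.< s → s ℕ.+ length cs ℕ.≤ ℓ → shifted-sum cs s ≈ 0E
  shifted-sum-vanishes []       s _   _ = sum-0 ℓ (λ k → (ζ ^ k) ^ s · 0E) (λ k _ → R.zeroʳ ((ζ ^ k) ^ s))
  shifted-sum-vanishes (c ∷ cs) s 0<s s+n≤ℓ = begin
    shifted-sum (c ∷ cs) s
      ≈⟨ shifted-sum-∷ s c cs ⟩
    c · power-sum s ⊕ shifted-sum cs (suc s)
      ≈⟨ ⊕-cong (·-cong (≈-refl {c}) (power-sum-vanishes s 0<s s<ℓ)) rest≈0 ⟩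
    c · 0E ⊕ 0E
      ≈⟨ solve 1 (λ c → c :* con 0ℤ :+ con 0ℤ := con 0ℤ) ≈-refl c ⟩
    0E                                        ∎
    where
    open ≈-Reasoning
    s<ℓ : s ℕ.< ℓ
    s<ℓ = ℕₚ.<-≤-trans (ℕₚ.m<m+n s {suc (length cs)} (s≤s z≤n)) s+n≤ℓ
    rest≈0 : shifted-sum cs (suc s) ≈ 0E
    rest≈0 = shifted-sum-vanishes cs (suc s) (s≤s z≤n) (subst (ℕ._≤ ℓ) (ℕₚ.+-suc s (length cs)) s+n≤ℓ)

  sum-over-roots-of-unity : ∀ cs → length cs ℕ.≤ ℓ → sum ℓ (λ k → eval cs (ζ ^ k)) ≈ constant cs · ι (+ ℓ)
  sum-over-roots-of-unity [] _ = ≈-trans (sum-0 ℓ (λ k → eval [] (ζ ^ k)) (λ _ _ → ≈-refl)) (≈-sym (R.zeroˡ (ι (+ ℓ))))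
  sum-over-roots-of-unity (c ∷ cs) n≤ℓ = begin
    sum ℓ (λ k → eval (c ∷ cs) (ζ ^ k))
      ≈⟨ sum-cong ℓ (λ k _ → ≈-sym (R.*-identityˡ (eval (c ∷ cs) (ζ ^ k)))) ⟩
    shifted-sum (c ∷ cs) 0
      ≈⟨ shifted-sum-∷ 0 c cs ⟩
    c · power-sum 0 ⊕ shifted-sum cs 1
      ≈⟨ ⊕-cong (·-cong (≈-refl {c}) power-sum-0) (shifted-sum-vanishes cs 1 (s≤s z≤n) n≤ℓ) ⟩
    c · ι (+ ℓ) ⊕ 0E
      ≈⟨ R.+-identityʳ (c · ι (+ ℓ)) ⟩
    c · ι (+ ℓ)                          ∎
    where open ≈-Reasoning

  -- A polynomial of degree < ℓ with constant term prime to p cannot vanish at every ζᵏ,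
  -- since the sum of its values is ℓ times that constant term.
  vanishing-factor : ∀ (f : E → E) cs c → constant cs ≈ ι c → ¬ p∣ c → length cs ℕ.≤ ℓ →
                     (∀ k → k ℕ.< ℓ → f (ζ ^ k) · eval cs (ζ ^ k) ≈ 0E) →
                     ∃[ k ] (k ℕ.< ℓ × f (ζ ^ k) ≈ 0E)
  vanishing-factor f cs c constant≈c p∤c n≤ℓ product≈0 = cases (ℕₚ.anyUpTo? (λ k → f (ζ ^ k) ≈? 0E) ℓ)
    where
    cases : Dec (∃[ k ] (k ℕ.< ℓ × f (ζ ^ k) ≈ 0E)) → ∃[ k ] (k ℕ.< ℓ × f (ζ ^ k) ≈ 0E)
    cases (yes root) = root
    cases (no ¬root) = ⊥-elim ([ p∤c , (λ p∣ℓ → p∤ℓ (ℤ∣.∣⇒∣ᵤ p∣ℓ)) ]′ (euclid (≋0⇒p∣ (≈₁ cℓ≈0))))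
      where
      P-vanishes : ∀ k → k ℕ.< ℓ → eval cs (ζ ^ k) ≈ 0E
      P-vanishes k k<ℓ = [ (λ fζᵏ≈0 → ⊥-elim (¬root (k , k<ℓ , fζᵏ≈0))) , (λ Pζᵏ≈0 → Pζᵏ≈0) ]′
                           (x·y≈0⇒x≈0∨y≈0 (product≈0 k k<ℓ))
      cℓ≈0 : ι (c * + ℓ) ≈ 0E
      cℓ≈0 = begin
        ι (c * + ℓ)                     ≡⟨ ι-* c (+ ℓ) ⟩
        ι c · ι (+ ℓ)                   ≈⟨ ·-cong constant≈c (≈-refl {ι (+ ℓ)}) ⟨
        constant cs · ι (+ ℓ)           ≈⟨ sum-over-roots-of-unity cs n≤ℓ ⟨
        sum ℓ (λ k → eval cs (ζ ^ k))   ≈⟨ sum-0 ℓ (λ k → eval cs (ζ ^ k)) P-vanishes ⟩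
        0E                              ∎
        where open ≈-Reasoning

  -- Some c ζᵏ is 1, else every Σᵢ (c ζᵏ)ⁱ would vanish; and ζᵏ ∉ 𝔽_p unless k = 0.
  ℓ-th-root-of-unity : ∀ c → c ℤ.^ ℓ ≋ 1ℤ → c ≋ 1ℤ
  ℓ-th-root-of-unity c cℓ≋1 =
    from-root (vanishing-factor (λ y → ι c · y ⊕ negE oneE) (powers (ι c) ℓ) 1ℤ
                 (≈-reflexive (constant-powers ℓ 0<ℓ)) p∤1 (ℕₚ.≤-reflexive (length-powers (ι c) ℓ)) product≈0)
    where
    constant-powers : ∀ n → 0 ℕ.< n → constant (powers (ι c) n) ≡ oneE
    constant-powers (suc n) _ = refl
    product≈0 : ∀ k → k ℕ.< ℓ → (ι c · ζ ^ k ⊕ negE oneE) · eval (powers (ι c) ℓ) (ζ ^ k) ≈ 0E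
    product≈0 k _ = begin
      (ι c · ζ ^ k ⊕ negE oneE) · eval (powers (ι c) ℓ) (ζ ^ k)
        ≈⟨ geometric-sum (ι c) (ζ ^ k) ℓ ⟩
      (ι c · ζ ^ k) ^ ℓ ⊕ negE oneE
        ≈⟨ ⊕-cong (^-distrib-· (ι c) (ζ ^ k) ℓ) (≈-refl {negE oneE}) ⟩
      ι c ^ ℓ · (ζ ^ k) ^ ℓ ⊕ negE oneE
        ≈⟨ ⊕-cong (·-cong (≈-trans (ι-^ c ℓ) (ι-cong cℓ≋1)) ([ζ^k]^ℓ≈1 k)) (≈-refl {negE oneE}) ⟩
      oneE · oneE ⊕ negE oneE
        ≈⟨ solve 0 (con 1ℤ :* con 1ℤ :- con 1ℤ := con 0ℤ) ≈-refl ⟩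
      0E                                                         ∎
      where open ≈-Reasoning
    from-root : ∃[ k ] (k ℕ.< ℓ × ι c · ζ ^ k ⊕ negE oneE ≈ 0E) → c ≋ 1ℤ
    from-root (zero      , _   , c·1-1≈0) =
      ≈₁ (≈-trans (≈-sym (R.*-identityʳ (ι c))) (≈0⇒≈ {ι c · oneE} {oneE} c·1-1≈0))
    from-root (k@(suc _) , k<ℓ , cζᵏ-1≈0) =
      ⊥-elim (ζ^∉𝔽ₚ k (s≤s z≤n) k<ℓ (·≈1⇒∈𝔽ₚ {ι c} {ζ ^ k} (ι-∈𝔽ₚ c) (≈0⇒≈ {ι c · ζ ^ k} {oneE} cζᵏ-1≈0)))

  -- y² - t y + 1 divides yˡ - 1 up to the remainder (α t ℓ - 1) + β t ℓ · y.
  quadratic-root : ∀ t → α t ℓ ≋ 1ℤ → β t ℓ ≋ 0ℤ → ∃[ k ] (k ℕ.< ℓ × quadratic t (ζ ^ k) ≈ 0E)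
  quadratic-root t α≋1 β≋0 =
    vanishing-factor (quadratic t) (quotient t ℓ) (β t (ℕ.pred ℓ)) (≈-reflexive (constant-quotient ℓ 0<ℓ))
                     p∤leading (ℕₚ.≤-reflexive (length-quotient t ℓ)) product≈0
    where
    constant-quotient : ∀ n → 0 ℕ.< n → constant (quotient t n) ≡ ι (β t (ℕ.pred n))
    constant-quotient (suc n) _ = refl
    α≡-β : ∀ n → 0 ℕ.< n → α t n ≡ - β t (ℕ.pred n)
    α≡-β (suc n) _ = refl
    p∤leading : ¬ p∣ β t (ℕ.pred ℓ)
    p∤leading p∣β = p∤1 (≋0⇒p∣ (begin
      1ℤ                   ≈⟨ α≋1 ⟨
      α t ℓ                ≡⟨ α≡-β ℓ 0<ℓ ⟩
      - β t (ℕ.pred ℓ)     ≈⟨ neg-cong (p∣⇒≋0 p∣β) ⟩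
      0ℤ                   ∎))
      where open ≋-Reasoning
    product≈0 : ∀ k → k ℕ.< ℓ → quadratic t (ζ ^ k) · eval (quotient t ℓ) (ζ ^ k) ≈ 0E
    product≈0 k _ = begin
      fQ
        ≈⟨ solve 2 (λ y fQ → fQ := (con 1ℤ :+ con 0ℤ :* y :+ fQ) :- con 1ℤ) ≈-refl y fQ ⟩
      oneE ⊕ 0E · y ⊕ fQ ⊕ negE oneE
        ≈⟨ ⊕-cong (⊕-cong (⊕-cong (ι-cong α≋1) (·-cong (ι-cong β≋0) (≈-refl {y}))) (≈-refl {fQ})) (≈-refl {negE oneE}) ⟨
      ι (α t ℓ) ⊕ ι (β t ℓ) · y ⊕ fQ ⊕ negE oneE
        ≈⟨ ⊕-cong (^-divMod-quadratic t y ℓ) (≈-refl {negE oneE}) ⟨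
      y ^ ℓ ⊕ negE oneE
        ≈⟨ ≈⇒≈0 ([ζ^k]^ℓ≈1 k) ⟩
      0E                                                   ∎
      where
      open ≈-Reasoning
      y = ζ ^ k
      fQ = quadratic t y · eval (quotient t ℓ) y

module Representations (p : ℕ) (p-prime : Prime p) (a b : ℤ) (irreducible : Irreducible p a b)
                       (ℓ : ℕ) (ℓ-prime : Prime ℓ) (ℓ∣p+1 : ℓ ∣ p ℕ.+ 1)
                       (ζ : E) (ζ-primitive : PrimitiveRoot p a b ℓ ζ) (ζ∉𝔽ₚ′ : NotInPrimeField p ζ) where

  open import Data.Integer using (_+_; _*_; -_; _-_)

  open ModPrime p p-prime
  open QuadraticField p p-prime a b irreducible
  open Matrices p p-prime
  p∤ℓ : ¬ p ∣ ℓ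
  p∤ℓ = ∣suc⇒∤ (prime⇒>1 p-prime) ℓ∣p+1

  open RootsOfUnity p p-prime a b irreducible ℓ ℓ-prime p∤ℓ ζ ζ-primitive ζ∉𝔽ₚ′
  open Solver using (solve; _:+_; _:*_; _:-_; :-_; _:=_; con)

  private
    module R = CommutativeRing ring

  z z̄ : ℕ → E
  z j = ζ ^ j
  z̄ j = ζ ^ (p ℕ.* j)

  trace : ℕ → ℤ
  trace = traceE a b ζ p

  z·z̄≈1 : ∀ j → z j · z̄ j ≈ oneE
  z·z̄≈1 j = ≈-trans (≈-sym (^-+ ζ j (p ℕ.* j))) (≈-trans (≈-reflexive (cong (ζ ^_) j+pj≡ℓqj)) (ζ^[ℓ*q]≈1 (q ℕ.* j)))
    where
    open ≡.≡-Reasoning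
    q = ℕ∣._∣_.quotient ℓ∣p+1
    j+pj≡ℓqj : j ℕ.+ p ℕ.* j ≡ ℓ ℕ.* (q ℕ.* j)
    j+pj≡ℓqj = begin
      (1 ℕ.+ p) ℕ.* j
        ≡⟨ cong (ℕ._* j) (≡.trans (ℕₚ.+-comm 1 p) (≡.trans (ℕ∣._∣_.equality ℓ∣p+1) (ℕₚ.*-comm q ℓ))) ⟩
      ℓ ℕ.* q ℕ.* j
        ≡⟨ ℕₚ.*-assoc ℓ q j ⟩
      ℓ ℕ.* (q ℕ.* j)       ∎

  norm-z≋1 : ∀ j → norm (z j) ≋ 1ℤ
  norm-z≋1 j = ℓ-th-root-of-unity (norm (z j))
    (≋-trans (≋-sym (norm-^ (z j) ℓ)) (≋-trans (norm-cong ([ζ^k]^ℓ≈1 j)) (≋-reflexive norm-oneE)))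

  -- Frobenius in disguise: z̄ j = z j ^ p is the inverse, hence the conjugate, of z j.
  z̄≈conj-z : ∀ j → z̄ j ≈ conj (z j)
  z̄≈conj-z j = begin
    z̄ j
      ≈⟨ R.*-identityʳ (z̄ j) ⟨
    z̄ j · oneE
      ≈⟨ ·-cong (≈-refl {z̄ j}) (≈-trans (·-conj (z j)) (ι-cong (norm-z≋1 j))) ⟨
    z̄ j · (z j · conj (z j))
      ≈⟨ solve 3 (λ w z c → w :* (z :* c) := (z :* w) :* c) ≈-refl (z̄ j) (z j) (conj (z j)) ⟩
    (z j · z̄ j) · conj (z j)
      ≈⟨ ·-cong (z·z̄≈1 j) (≈-refl {conj (z j)}) ⟩
    oneE · conj (z j)
      ≈⟨ R.*-identityˡ (conj (z j)) ⟩
    conj (z j)                ∎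
    where open ≈-Reasoning

  z⊕z̄≈trace : ∀ j → z j ⊕ z̄ j ≈ ι (trace j)
  z⊕z̄≈trace j =
    ≋-refl & ≋-trans (+-cong (≋-refl {proj₂ (z j)}) (≈₂ (z̄≈conj-z j))) (≋-reflexive (ℤₚ.+-inverseʳ (proj₂ (z j))))

  quadratic-trace : ∀ j → quadratic (trace j) (z j) ≈ 0E
  quadratic-trace j = begin
    z j · z j ⊕ negE (ι (trace j) · z j) ⊕ oneE
      ≈⟨ ⊕-cong (⊕-cong (≈-refl {z j · z j}) (negE-cong (·-cong (≈-sym (z⊕z̄≈trace j)) (≈-refl {z j}))))
                (≈-sym (z·z̄≈1 j)) ⟩
    z j · z j ⊕ negE ((z j ⊕ z̄ j) · z j) ⊕ z j · z̄ j
      ≈⟨ solve 2 (λ z w → z :* z :- (z :+ w) :* z :+ z :* w := con 0ℤ) ≈-refl (z j) (z̄ j) ⟩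
    0E ∎
    where open ≈-Reasoning

  z∉𝔽ₚ : ∀ j → IsUnitRep ℓ j → ¬ z j ∈𝔽ₚ
  z∉𝔽ₚ j (0<j , j<ℓ) = ζ^∉𝔽ₚ j 0<j j<ℓ

  V : ℕ → M2
  V = Vmat p a b ζ

  det-V : ∀ j → det (V j) ≡ 1ℤ
  det-V j = expand (trace j)
    where
    expand : ∀ t → + 0 * t - - (+ 1) * + 1 ≡ 1ℤ
    expand = solve-∀

  tr-V : ∀ j → tr (V j) ≡ trace j
  tr-V j = ℤₚ.+-identityˡ (trace j)

  V^ℓ≈I : ∀ j → IsUnitRep ℓ j → powM (V j) ℓ ≈M idM
  V^ℓ≈I j unit = powM≈idM (V j) (≋-reflexive (det-V j)) ℓ
    (subst (λ t → α t ℓ ≋ 1ℤ) (≡.sym (tr-V j)) (proj₁ α≋1∧β≋0))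
    (subst (λ t → β t ℓ ≋ 0ℤ) (≡.sym (tr-V j)) (proj₂ α≋1∧β≋0))
    where
    α≋1∧β≋0 : α (trace j) ℓ ≋ 1ℤ × β (trace j) ℓ ≋ 0ℤ
    α≋1∧β≋0 = coordinates-of-1 (z∉𝔽ₚ j unit) (≈-trans (≈-sym (^-root-of-quadratic (quadratic-trace j) ℓ)) ([ζ^k]^ℓ≈1 j))

  apply-V¹ : ∀ j v → apply (Vrep p a b ζ j 1) v ≡ apply (V j) v
  apply-V¹ j v = cong (λ B → apply B v) (mulM-identityʳ (V j))

  isRep : ∀ j → IsUnitRep ℓ j → IsRep p ℓ (Vrep p a b ζ j)
  isRep j unit = ≈M⇒≈M[p] (≈M-refl {idM}) , (λ g h → ≈M⇒≈M[p] (powM-+ (V j) g h)) , ≈M⇒≈M[p] (V^ℓ≈I j unit)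

  spans : ∀ j → IsUnitRep ℓ j → ∀ v → ¬ (v ≈V[ p ] zeroV) → Spans p v (apply (Vrep p a b ζ j 1) v)
  spans j unit v@(x , y) v≉0 = subst (Spans p v) (≡.sym (apply-V¹ j v))
    (invertible⇒Spans v (apply (V j) v) (det≉0⇒invertible (columns v (apply (V j) v)) p∤det))
    where
    t = trace j
    p∤det : ¬ p∣ det (columns v (apply (V j) v))
    p∤det p∣det = v≉0 (≈V⇒≈V[p] (p∣⇒≋0 p∣x &V p∣⇒≋0 p∣y))
      where
      form : ∀ t x y → x * (+ 1 * x + t * y) - (+ 0 * x + - (+ 1) * y) * y ≡ (- x) * (- x) - t * (- x) * y + y * y
      form = solve-∀
      p∣-x∧p∣y : p∣ (- x) × p∣ y
      p∣-x∧p∣y = anisotropic (trace j) (z j) (z∉𝔽ₚ j unit) (quadratic-trace j) (- x) y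
                   (p∣⇒≋0 (subst p∣_ (form t x y) p∣det))
      p∣x : p∣ x
      p∣x = subst p∣_ (ℤₚ.neg-involutive x) (ℤ∣.∣m⇒∣-m (proj₁ p∣-x∧p∣y))
      p∣y = proj₂ p∣-x∧p∣y

  V²-relation : ∀ j v → apply (Vrep p a b ζ j 2) v ≈V[ p ] addV (scaleV (trace j) (apply (Vrep p a b ζ j 1) v)) (negV v)
  V²-relation j v@(x , y) = ≈V⇒≈V[p] (≈V-reflexive (begin
    apply (mulM (V j) (mulM (V j) idM)) v
      ≡⟨ cong (λ B → apply (mulM (V j) B) v) (mulM-identityʳ (V j)) ⟩
    apply (mulM (V j) (V j)) v
      ≡⟨ apply-mulM (V j) (V j) v ⟩
    apply (V j) (apply (V j) v)
      ≡⟨ cong₂ _,_ (upper t x y) (lower t x y) ⟩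
    addV (scaleV t (apply (V j) v)) (negV v)
      ≡⟨ cong (λ w → addV (scaleV t w) (negV v)) (apply-V¹ j v) ⟨
    addV (scaleV t (apply (mulM (V j) idM) v)) (negV v) ∎))
    where
    open ≡.≡-Reasoning
    t = trace j
    upper : ∀ t x y → + 0 * (+ 0 * x + - (+ 1) * y) + - (+ 1) * (+ 1 * x + t * y) ≡ t * (+ 0 * x + - (+ 1) * y) + - x
    upper = solve-∀
    lower : ∀ t x y → + 1 * (+ 0 * x + - (+ 1) * y) + t * (+ 1 * x + t * y) ≡ t * (+ 1 * x + t * y) + - y
    lower = solve-∀

  conditionB : ∀ j → IsUnitRep ℓ j → ConditionB p (Vrep p a b ζ j)
  conditionB j unit v@(x , y) fixed = ≈V⇒≈V[p] (p∣⇒≋0 p∣x &V p∣⇒≋0 p∣y)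
    where
    t = trace j
    Vv≈v : apply (V j) v ≈V v
    Vv≈v = subst (_≈V v) (apply-V¹ j v) (≈V[p]⇒≈V (fixed 1))
    p∣y : p∣ y
    p∣y = proj₂ (anisotropic (trace j) (z j) (z∉𝔽ₚ j unit) (quadratic-trace j) y y
            (≋-via _ (form t x y) (ℤ∣.∣n⇒∣m*n y (ℤ∣.∣m∣n⇒∣m-n (get≋ (≋-sym (≈V₁ Vv≈v))) (get≋ (≈V₂ Vv≈v))))))
      where
      form : ∀ t x y → y * y - t * y * y + y * y - 0ℤ
                       ≡ y * ((x - (+ 0 * x + - (+ 1) * y)) - ((+ 1 * x + t * y) - y))
      form = solve-∀
    p∣x : p∣ x
    p∣x = ≋0⇒p∣ (≋-trans (≋-sym (≈V₁ Vv≈v)) (≋-trans (≋-reflexive (minus-y x y)) (p∣⇒≋0 (ℤ∣.∣m⇒∣-m p∣y))))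
      where
      minus-y : ∀ x y → + 0 * x + - (+ 1) * y ≡ - y
      minus-y = solve-∀

  -- g fixes the line through w, so acts on it by a scalar d; then dˡ = 1 forces d = 1.
  conditionC : ∀ A → powM A ℓ ≈M idM → ∀ w → ¬ (w ≈V[ p ] zeroV) → ConditionC p (powM A) w
  conditionC A Aˡ≈I w w≉0 g (stabilises , _) c = ≈V⇒≈V[p] (begin
    apply B (scaleV c w)   ≡⟨ apply-scaleV B c w ⟩
    scaleV c (apply B w)   ≈⟨ scaleV-cong (≋-refl {c}) Bw≈dw ⟩
    scaleV c (scaleV d w)  ≈⟨ scaleV-cong (≋-refl {c}) (scaleV-cong d≋1 (≈V-refl {w})) ⟩
    scaleV c (scaleV 1ℤ w) ≡⟨ cong (scaleV c) (scaleV-1 w) ⟩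
    scaleV c w             ∎)
    where
    open ≈V-Reasoning
    B = powM A g
    d = proj₁ (stabilises 1ℤ)
    Bw≈dw : apply B w ≈V scaleV d w
    Bw≈dw = subst (λ u → apply B u ≈V scaleV d w) (scaleV-1 w) (≈V[p]⇒≈V (proj₂ (stabilises 1ℤ)))
    Bˡ≈I : powM B ℓ ≈M idM
    Bˡ≈I = ≈M-trans (powM-* A g ℓ) (≈M-trans (≈M-reflexive (cong (powM A) (ℕₚ.*-comm g ℓ)))
             (≈M-trans (≈M-sym (powM-* A ℓ g)) (≈M-trans (powM-cong g Aˡ≈I) (powM-idM g))))
    dˡw≈w : scaleV (d ℤ.^ ℓ) w ≈V w
    dˡw≈w = ≈V-sym (≈V-trans (≈V-reflexive (≡.sym (apply-idM w)))
              (≈V-trans (apply-congʳ w (≈M-sym Bˡ≈I)) (eigenvector-powM B w d Bw≈dw ℓ)))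
    d≋1 : d ≋ 1ℤ
    d≋1 = ℓ-th-root-of-unity d (scaleV≈⇒≋1 (λ w≈0 → w≉0 (≈V⇒≈V[p] w≈0)) dˡw≈w)

  ≈M⇒RepIso : ∀ {A B} → A ≈M B → RepIso p (powM A) (powM B)
  ≈M⇒RepIso {A} {B} A≈B =
    idM , idM , ≈M⇒≈M[p] (≈M-reflexive (mulM-identityˡ idM)) , ≈M⇒≈M[p] (≈M-reflexive (mulM-identityˡ idM)) ,
    λ g → ≈M⇒≈M[p] (≈M-trans (≈M-reflexive (mulM-identityˡ (powM A g)))
                     (≈M-trans (powM-cong g A≈B) (≈M-reflexive (≡.sym (mulM-identityʳ (powM B g))))))

  trace≋⇒V≈ : ∀ j₁ j₂ → trace j₁ ≋ trace j₂ → V j₁ ≈M V j₂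
  trace≋⇒V≈ j₁ j₂ h = ≈V-refl &M (≋-refl &V h)

  RepIso⇒trace≋ : ∀ j₁ j₂ → RepIso p (Vrep p a b ζ j₁) (Vrep p a b ζ j₂) → trace j₁ ≋ trace j₂
  RepIso⇒trace≋ j₁ j₂ (P , Q , PQ≈I , QP≈I , intertwines) = ≋-sym (begin
    trace j₂       ≡⟨ tr-V j₂ ⟨
    tr (V j₂)      ≈⟨ intertwined⇒tr≋ (V j₁) (V j₂) P Q (≈M[p]⇒≈M PQ≈I) (≈M[p]⇒≈M QP≈I) PV₁≈V₂P ⟩
    tr (V j₁)      ≡⟨ tr-V j₁ ⟩
    trace j₁       ∎)
    where
    open ≋-Reasoning
    PV₁≈V₂P : mulM P (V j₁) ≈M mulM (V j₂) P
    PV₁≈V₂P = ≈M-trans (mulM-congˡ P (≈M-reflexive (≡.sym (mulM-identityʳ (V j₁)))))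
                (≈M-trans (≈M[p]⇒≈M (intertwines 1)) (mulM-congʳ P (≈M-reflexive (mulM-identityʳ (V j₂)))))

  -- (z₁ - z₂)(z₁ z₂ - 1) = z₁ z₂ (t₁ - t₂) when z̄ᵢ = zᵢ⁻¹ and tᵢ = zᵢ + z̄ᵢ.
  trace≋⇒ModEq : ∀ j₁ j₂ → IsUnitRep ℓ j₁ → IsUnitRep ℓ j₂ → trace j₁ ≋ trace j₂ →
                 ModEq ℓ (+ j₁) (+ j₂) ⊎ ModEq ℓ (+ j₁) (+ (p ℕ.* j₂))
  trace≋⇒ModEq j₁ j₂ (0<j₁ , j₁<ℓ) (_ , j₂<ℓ) t₁≋t₂ =
    [ (λ z₁-z₂≈0 → inj₁ (subst (λ j → ModEq ℓ (+ j₁) (+ j))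
                             (ζ^-injective j₁ j₂ j₁<ℓ j₂<ℓ (≈0⇒≈ z₁-z₂≈0)) (ModEq-refl ℓ (+ j₁))))
    , (λ z₁z₂-1≈0 → inj₂ (+≡ℓ⇒ModEq-p ℓ∣p+1 j₁ j₂
        (ζ^[m+n]≈1⇒≡ℓ j₁ j₂ 0<j₁ j₁<ℓ j₂<ℓ (≈-trans (^-+ ζ j₁ j₂) (≈0⇒≈ {z j₁ · z j₂} {oneE} z₁z₂-1≈0)))))
    ]′ (x·y≈0⇒x≈0∨y≈0 factorisation)
    where
    z₁ = z j₁
    z₂ = z j₂
    z̄₁ = z̄ j₁
    z̄₂ = z̄ j₂
    sums≈ : z₁ ⊕ z̄₁ ≈ z₂ ⊕ z̄₂
    sums≈ = ≈-trans (z⊕z̄≈trace j₁) (≈-trans (ι-cong t₁≋t₂) (≈-sym (z⊕z̄≈trace j₂)))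
    factorisation : (z₁ ⊕ negE z₂) · (z₁ · z₂ ⊕ negE oneE) ≈ 0E
    factorisation = begin
      (z₁ ⊕ negE z₂) · (z₁ · z₂ ⊕ negE oneE)
        ≈⟨ solve 4 (λ z₁ z₂ w₁ w₂ → (z₁ :- z₂) :* (z₁ :* z₂ :- con 1ℤ)
             := z₁ :* z₂ :* ((z₁ :+ w₁) :- (z₂ :+ w₂)) :- z₂ :* (z₁ :* w₁ :- con 1ℤ) :+ z₁ :* (z₂ :* w₂ :- con 1ℤ))
             ≈-refl z₁ z₂ z̄₁ z̄₂ ⟩
      z₁ · z₂ · ((z₁ ⊕ z̄₁) ⊕ negE (z₂ ⊕ z̄₂)) ⊕ negE (z₂ · (z₁ · z̄₁ ⊕ negE oneE)) ⊕ z₁ · (z₂ · z̄₂ ⊕ negE oneE)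
        ≈⟨ ⊕-cong (⊕-cong (·-cong (≈-refl {z₁ · z₂}) (≈⇒≈0 sums≈))
                          (negE-cong (·-cong (≈-refl {z₂}) (≈⇒≈0 (z·z̄≈1 j₁)))))
                  (·-cong (≈-refl {z₁}) (≈⇒≈0 (z·z̄≈1 j₂))) ⟩
      z₁ · z₂ · 0E ⊕ negE (z₂ · 0E) ⊕ z₁ · 0E
        ≈⟨ solve 2 (λ z₁ z₂ → z₁ :* z₂ :* con 0ℤ :- z₂ :* con 0ℤ :+ z₁ :* con 0ℤ := con 0ℤ) ≈-refl z₁ z₂ ⟩
      0E ∎
      where open ≈-Reasoning

  ModEq⇒trace≋ : ∀ j₁ j₂ → IsUnitRep ℓ j₁ → IsUnitRep ℓ j₂ →
                 ModEq ℓ (+ j₁) (+ j₂) ⊎ ModEq ℓ (+ j₁) (+ (p ℕ.* j₂)) → trace j₁ ≋ trace j₂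
  ModEq⇒trace≋ j₁ j₂ (_ , j₁<ℓ) (_ , j₂<ℓ) (inj₁ j₁≡j₂) =
    ≋-reflexive (cong trace (ζ^-injective j₁ j₂ j₁<ℓ j₂<ℓ (ζ^-resp-ModEq j₁ j₂ j₁≡j₂)))
  ModEq⇒trace≋ j₁ j₂ _ _ (inj₂ j₁≡pj₂) =
    ≋-trans (≈₁ (⊕-cong (ζ^-resp-ModEq j₁ (p ℕ.* j₂) j₁≡pj₂)
                        (ζ^-resp-ModEq (p ℕ.* j₁) j₂ (ModEq-p-swap ℓ∣p+1 j₁ j₂ j₁≡pj₂))))
            (≋-reflexive (ℤₚ.+-comm (proj₁ (z̄ j₂)) (proj₁ (z j₂))))

  isomorphic⇔ : ∀ j₁ j₂ → IsUnitRep ℓ j₁ → IsUnitRep ℓ j₂ →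
                RepIso p (Vrep p a b ζ j₁) (Vrep p a b ζ j₂) ⇔ (ModEq ℓ (+ j₁) (+ j₂) ⊎ ModEq ℓ (+ j₁) (+ (p ℕ.* j₂)))
  isomorphic⇔ j₁ j₂ u₁ u₂ = mk⇔
    (λ iso → trace≋⇒ModEq j₁ j₂ u₁ u₂ (RepIso⇒trace≋ j₁ j₂ iso))
    (λ congruent → ≈M⇒RepIso (trace≋⇒V≈ j₁ j₂ (ModEq⇒trace≋ j₁ j₂ u₁ u₂ congruent)))

  module Classification (ρ : ℕ → M2) (ρ-rep : IsRep p ℓ ρ) (ρ-nontrivial : NonTrivial p ρ) where

    A : M2
    A = ρ 1

    ρ≈A^ : ∀ g → ρ g ≈M powM A g
    ρ≈A^ zero    = ≈M[p]⇒≈M (proj₁ ρ-rep)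
    ρ≈A^ (suc g) = ≈M-trans (≈M[p]⇒≈M (proj₁ (proj₂ ρ-rep) 1 g)) (mulM-congˡ A (ρ≈A^ g))

    Aˡ≈I : powM A ℓ ≈M idM
    Aˡ≈I = ≈M-trans (≈M-sym (ρ≈A^ ℓ)) (≈M[p]⇒≈M (proj₂ (proj₂ ρ-rep)))

    det-A≋1 : det A ≋ 1ℤ
    det-A≋1 = ℓ-th-root-of-unity (det A) (≋-trans (≋-sym (det-powM A ℓ)) (det-cong Aˡ≈I))

    non-scalar : ∀ c → ¬ (A ≈M scalarM c)
    non-scalar c A≈c = proj₂ ρ-nontrivial (≈M⇒≈M[p] (begin
      ρ g          ≈⟨ ρ≈A^ g ⟩
      powM A g     ≈⟨ powM-cong g A≈I ⟩
      powM idM g   ≈⟨ powM-idM g ⟩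
      idM          ∎))
      where
      open ≈M-Reasoning
      g = proj₁ ρ-nontrivial
      cˡ≋1 : c ℤ.^ ℓ ≋ 1ℤ
      cˡ≋1 = ≈V₁ (row₁ (≈M-trans (≈M-reflexive (≡.sym (powM-scalarM c ℓ))) (≈M-trans (powM-cong ℓ (≈M-sym A≈c)) Aˡ≈I)))
      A≈I : A ≈M idM
      A≈I = ≈M-trans A≈c (scalarM-cong (ℓ-th-root-of-unity c cˡ≋1))

    v w : V2
    v = proj₁ (cyclic-vector A non-scalar)
    w = apply A v

    S : M2
    S = columns v w

    S-invertible : Invertible S
    S-invertible = det≉0⇒invertible S (proj₂ (cyclic-vector A non-scalar))

    T : ℤ
    T = tr A

    Aw≈-v+Tw : apply A w ≈V addV (scaleV (- 1ℤ) v) (scaleV T w)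
    Aw≈-v+Tw = ≈V-trans (≈V-reflexive (cayley-hamilton-apply A v))
                 (addV-cong (scaleV-cong (neg-cong det-A≋1) (≈V-refl {v})) (≈V-refl {scaleV T w}))

    -- Aˡ v = α v + β w equals v, and v, w are independent.
    α≋1∧β≋0 : α T ℓ ≋ 1ℤ × β T ℓ ≋ 0ℤ
    α≋1∧β≋0 = mk≋ (≋0⇒p∣ (proj₁ coefficients≋0)) , proj₂ coefficients≋0
      where
      αv+βw≈v : addV (scaleV (α T ℓ) v) (scaleV (β T ℓ) w) ≈V v
      αv+βw≈v = begin
        addV (scaleV (α T ℓ) v) (scaleV (β T ℓ) w)  ≡⟨ apply-polyM (α T ℓ) (β T ℓ) A v ⟨
        apply (polyM (α T ℓ) (β T ℓ) A) v          ≈⟨ apply-congʳ v (≈M-sym (powM≈polyM-α-β A det-A≋1 ℓ)) ⟩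
        apply (powM A ℓ) v                         ≈⟨ apply-congʳ v Aˡ≈I ⟩
        apply idM v                                ≡⟨ apply-idM v ⟩
        v                                          ∎
        where open ≈V-Reasoning
      shift : ∀ x y v w → (x - 1ℤ) * v + y * w - 0ℤ ≡ (x * v + y * w) - v
      shift = solve-∀
      coefficients≋0 : α T ℓ - 1ℤ ≋ 0ℤ × β T ℓ ≋ 0ℤ
      coefficients≋0 = invertible⇒independent v w (α T ℓ - 1ℤ) (β T ℓ) S-invertible
        (≋-via _ (shift (α T ℓ) (β T ℓ) (proj₁ v) (proj₁ w)) (get≋ (≈V₁ αv+βw≈v)) &V
         ≋-via _ (shift (α T ℓ) (β T ℓ) (proj₂ v) (proj₂ w)) (get≋ (≈V₂ αv+βw≈v)))

    root : ∃[ k ] (k ℕ.< ℓ × quadratic T (ζ ^ k) ≈ 0E)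
    root = quadratic-root T (proj₁ α≋1∧β≋0) (proj₂ α≋1∧β≋0)

    k : ℕ
    k = proj₁ root

    k<ℓ : k ℕ.< ℓ
    k<ℓ = proj₁ (proj₂ root)

    -- T = 2 would make β T ℓ = ℓ.
    T≉2 : ¬ (T ≋ + 2)
    T≉2 T≋2 = p∤ℓ (ℤ∣.∣⇒∣ᵤ (≋0⇒p∣ (begin
      + ℓ          ≡⟨ proj₂ (α-β-2 ℓ) ⟨
      β (+ 2) ℓ    ≈⟨ proj₂ (α-β-cong T≋2 ℓ) ⟨
      β T ℓ        ≈⟨ proj₂ α≋1∧β≋0 ⟩
      0ℤ           ∎)))
      where open ≋-Reasoning

    0<k : 0 ℕ.< k
    0<k = ℕₚ.n≢0⇒n>0 k≢0
      where
      k≢0 : k ≢ 0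
      k≢0 k≡0 = T≉2 (≋-sym (≈₁ (≈0⇒≈ {ι (+ 2)} {ι T} (begin
        ι (+ 2) ⊕ negE (ι T)
          ≈⟨ solve 1 (λ T → con (+ 2) :- T := con 1ℤ :* con 1ℤ :- T :* con 1ℤ :+ con 1ℤ) ≈-refl (ι T) ⟩
        quadratic T oneE
          ≡⟨ cong (λ n → quadratic T (ζ ^ n)) k≡0 ⟨
        quadratic T (ζ ^ k)
          ≈⟨ proj₂ (proj₂ root) ⟩
        0E                                        ∎))))
        where open ≈-Reasoning

    T≋trace : T ≋ trace k
    T≋trace = ≈₁ (≈-trans (≈-sym (≈0⇒≈ {z k ⊕ z̄ k} {ι T} y+z̄-T≈0)) (z⊕z̄≈trace k))
      where
      y = z k
      y+z̄-T≈0 : (y ⊕ z̄ k) ⊕ negE (ι T) ≈ 0E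
      y+z̄-T≈0 = begin
        (y ⊕ z̄ k) ⊕ negE (ι T)
          ≈⟨ solve 3 (λ y w T → (y :+ w) :- T := y :* con 1ℤ :- T :* con 1ℤ :+ w) ≈-refl y (z̄ k) (ι T) ⟩
        y · oneE ⊕ negE (ι T · oneE) ⊕ z̄ k
          ≈⟨ ⊕-cong (⊕-cong (·-cong (≈-refl {y}) (z·z̄≈1 k)) (negE-cong (·-cong (≈-refl {ι T}) (z·z̄≈1 k))))
                    (≈-refl {z̄ k}) ⟨
        y · (y · z̄ k) ⊕ negE (ι T · (y · z̄ k)) ⊕ z̄ k
          ≈⟨ solve 3 (λ y w T → (y :* y :- T :* y :+ con 1ℤ) :* w := y :* (y :* w) :- T :* (y :* w) :+ w)
                     ≈-refl y (z̄ k) (ι T) ⟨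
        quadratic T y · z̄ k
          ≈⟨ ·-cong (proj₂ (proj₂ root)) (≈-refl {z̄ k}) ⟩
        0E · z̄ k
          ≈⟨ R.zeroˡ (z̄ k) ⟩
        0E                                              ∎
        where open ≈-Reasoning

    AS≈SVₖ : mulM A S ≈M mulM S (V k)
    AS≈SVₖ = companion-basis A v (trace k)
      (≈V-trans Aw≈-v+Tw (addV-cong (≈V-refl {scaleV (- 1ℤ) v}) (scaleV-cong T≋trace (≈V-refl {w}))))

    P : M2
    P = proj₁ S-invertible

    isomorphic : RepIso p ρ (Vrep p a b ζ k)
    isomorphic = P , S , ≈M⇒≈M[p] (proj₁ (proj₂ S-invertible)) , ≈M⇒≈M[p] (proj₂ (proj₂ S-invertible)) ,
      λ g → ≈M⇒≈M[p] (≈M-trans (mulM-congˡ P (ρ≈A^ g))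
                        (intertwines-powM A (V k) P (invertible-intertwines A (V k) S S-invertible AS≈SVₖ) g))

  classification : ∀ (ρ : ℕ → M2) → IsRep p ℓ ρ → NonTrivial p ρ → ∃[ j ] (IsUnitRep ℓ j × RepIso p ρ (Vrep p a b ζ j))
  classification ρ ρ-rep ρ-nontrivial = k , (0<k , k<ℓ) , isomorphic
    where open Classification ρ ρ-rep ρ-nontrivial

open import Data.Nat using (_*_)

proposition5p7 :
  (p ℓ : ℕ) → Prime p → Prime ℓ → ¬ (ℓ ≡ 2) → D₂ p (p * ℓ) →
  (a b : ℤ) → Irreducible p a b →
  (ζ : E) → PrimitiveRoot p a b ℓ ζ → NotInPrimeField p ζ →
    -- V^j is a representation and (i)
    (∀ j → IsUnitRep ℓ j →
      IsRep p ℓ (Vrep p a b ζ j) ×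
      (∀ (v : V2) → ¬ (v ≈V[ p ] zeroV) →
        Spans p v (apply (Vrep p a b ζ j 1) v) ×
        (apply (Vrep p a b ζ j 2) v ≈V[ p ]
          addV (scaleV (traceE a b ζ p j) (apply (Vrep p a b ζ j 1) v)) (negV v)))) ×
    -- (ii)
    (∀ j₁ j₂ → IsUnitRep ℓ j₁ → IsUnitRep ℓ j₂ →
      (RepIso p (Vrep p a b ζ j₁) (Vrep p a b ζ j₂) ⇔
        (ModEq ℓ (+ j₁) (+ j₂) ⊎ ModEq ℓ (+ j₁) (+ (p * j₂))))) ×
    -- (iii)
    (∀ (ρ : ℕ → M2) → IsRep p ℓ ρ → NonTrivial p ρ →
      ∃[ j ] (IsUnitRep ℓ j × RepIso p ρ (Vrep p a b ζ j))) ×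
    -- (iv)
    (∀ j → IsUnitRep ℓ j →
      ConditionB p (Vrep p a b ζ j) ×
      (∀ (w : V2) → ¬ (w ≈V[ p ] zeroV) → ConditionC p (Vrep p a b ζ j) w))
proposition5p7 p ℓ p-prime ℓ-prime _ pℓ∈D₂ a b irreducible ζ ζ-primitive ζ∉𝔽ₚ =
    (λ j unit → isRep j unit , λ v v≉0 → spans j unit v v≉0 , V²-relation j v)
  , isomorphic⇔
  , classification
  , (λ j unit → conditionB j unit , conditionC (V j) (V^ℓ≈I j unit))
  where
  open Representations p p-prime a b irreducible ℓ ℓ-prime (D₂⇒∣suc ℓ-prime pℓ∈D₂) ζ ζ-primitive ζ∉𝔽ₚ
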